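{- Let $\mathcal{H}_1=\{H_{1,1},\dots,H_{1,r}\}$ be a finite family of tournaments with the $(\mathcal{F},v,\eta)$-strong EH-property and $\mathcal{H}_2=\{H_{2,1},\dots,H_{2,s}\}$ a finite family of tournaments with the $(\mathcal{G},v,\eta)$-strong EH-property (same $v,\eta$), where the vertex sets of the tournaments of $\mathcal{H}_1$ are disjoint from those of $\mathcal{H}_2$, and assume $\langle\mathcal{F},\mathcal{G}\rangle=0$. Then the family $\mathcal{H}=\mathcal{H}_1^{\mathcal{F}}\oplus\mathcal{H}_2^{\mathcal{G}}$ has the $(\mathcal{F}\oplus\mathcal{G},v,\eta)$-strong EH-property.
   Context: Tournaments are finite; subtournament = induced subtournament; transitive = no directed cycle; $tr(T)$ = maximum size of a transitive subtournament of $T$. $V_1$ is complete to $V_2$ if every vertex of $V_1$ has an edge to every vertex of $V_2$. For disjoint nonempty $X,Y$, $d(X,Y)=e_{X,Y}/(|X||Y|)$, $e_{X,Y}$ = number of edges $(x,y)$ with $x\in X,y\in Y$. For a $\{0,1\}$-vector $v$ of length $m$, $\zeta^v(i)=|\{j\le i:v(j)=1\}|$; $\eta$ is a vector of positive integers of length $\zeta^v(m)$; $k=|\{j:v(j)=0\}|+\sum_i\eta(i)$. For a tournament $T$, $c>0$, $0\le\lambda<1$, a $(v,\eta,c,\lambda)$-m-sequence in $T$ is a sequence $\chi=(S_1,\dots,S_m)$ of pairwise disjoint subsets of $V(T)$ such that: if $v(i)=1$, $S_i$ induces a transitive subtournament partitioned into $S_{i,1},\dots,S_{i,\eta(\zeta^v(i))}$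 with $S_{i,a}$ complete to $S_{i,b}$ for $a<b$ and $|S_{i,a}|\ge c\,tr(T)$; if $v(i)=0$, $|S_i|\ge c|T|$; $d(S_i,S_j)\ge1-\lambda$ for $i<j$. Its long representation $l(\chi)=(T_1,\dots,T_k)$ replaces each $S_i$ with $v(i)=1$ by $S_{i,1},\dots,S_{i,\eta(\zeta^v(i))}$ in order; $V(\chi)=\bigcup S_i$. A $c'$-strong pair in $\chi$ is a pair $(A,B)$ of disjoint subsets of $V(\chi)$ with $|A|\ge c'|T|$, either $|B|\ge c'|T|$ or ($B$ transitive and $|B|\ge c'\,tr(T)$), and $d(A,B)=1$ or $d(B,A)=1$. For $\mathcal{H}=\{H_1,\dots,H_t\}$, $V(H_i)=\{h^i_1,\dots\}$, and $\mathcal{F}=\{f_1,\dots,f_t\}$ with $f_i:V(H_i)\to\{1,\dots,k\}$ injective ($f_i$ associated with $H_i$), $\mathcal{H}$ has the $(\mathcal{F},v,\eta)$-strong EH-property if for every $c_1>0$ there exist $\lambda_0>0,c_2>0$ such that for every tournament $T$, $0\le\lambda\le\lambda_0$ and $(v,\eta,c_1,\lambda)$-m-sequence $\chi$ in $T$ with $l(\chi)=(T_1,\dots,T_k)$, either there are $i$ and $x_j\in T_{f_i(h^i_j)}$ with $x_j\mapsto h^i_j$ an isomorphism from the subtournament induced on $\{x_j\}$ onto $H_i$, or $\chi$ contains a $c_2$-strong pair. Products: an edge $(x,y)$ is backward under an ordering if $y$ precedes $x$. For tournaments $H_1,H_2$ with disjoint vertex sets and injective $f_1:V(H_1)\to\mathbb{N}$,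 $f_2:V(H_2)\to\mathbb{N}$ with $f_1(x)\ne f_2(y)$ for all $x,y$ (written $\langle f_1,f_2\rangle=0$), let $f_1\oplus f_2$ be the function on $V(H_1)\cup V(H_2)$ equal to $f_1$ on $V(H_1)$ and $f_2$ on $V(H_2)$; let $\theta_i$ be the ordering of $V(H_i)$ by increasing $f_i$ and $\theta$ that of $V(H_1)\cup V(H_2)$ by increasing $f_1\oplus f_2$. The product $H_1^{f_1}\oplus H_2^{f_2}$ is the tournament on $V(H_1)\cup V(H_2)$ whose backward edges under $\theta$ are exactly the backward edges of $H_1$ under $\theta_1$ together with the backward edges of $H_2$ under $\theta_2$. For families $\mathcal{F}=\{f_1,\dots,f_r\}$, $\mathcal{G}=\{g_1,\dots,g_s\}$: $\langle\mathcal{F},\mathcal{G}\rangle=0$ means $\langle f,g\rangle=0$ for all $f\in\mathcal{F},g\in\mathcal{G}$; $\mathcal{F}\oplus\mathcal{G}=\{f_i\oplus g_j\}$; and $\mathcal{H}_1^{\mathcal{F}}\oplus\mathcal{H}_2^{\mathcal{G}}=\{H_{1,i}^{f_i}\oplus H_{2,j}^{g_j}\}$, where the member $H_{1,i}^{f_i}\oplus H_{2,j}^{g_j}$ is associated with the function $f_i\oplus g_j$.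
   Formalization: The constants c₁, λ₀, c₂ and λ in the strong EH-property range over the rationals. -}

module Defs where

open import Data.Bool using (Bool; true; false; _∧_; if_then_else_; not)
open import Data.Nat as ℕ using (ℕ; zero; suc; _+_; _∸_)
open import Data.Fin as Fin using (Fin; zero; suc; _↑ˡ_; _↑ʳ_; splitAt)
open import Data.Fin.Subset as Sub using (Subset; _∈_; _⊆_; ∣_∣; ⋃; ⊥)
open import Data.Vec as Vec using (Vec; []; _∷_; lookup; toList)
open import Data.List as List using (List; []; _∷_; _++_; [_]; map; concatMap; allFin; cartesianProductWith)
open import Data.Nat.ListAction using (sum)
open import Data.List.Relation.Unary.All using (All)
open import Data.List.Relation.Unary.Any using (Any)
open import Data.List.Relation.Unary.Unique.Propositional using (Unique)
open import Data.List.Membership.Propositional as LMem using ()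
open import Data.Integer using (+_)
open import Data.Rational as ℚ using (ℚ; _/_; 1ℚ; Positive; NonNegative)
open import Data.Product using (Σ; ∃; _×_; _,_)
open import Data.Sum using (_⊎_; inj₁; inj₂)
open import Data.Empty renaming (⊥ to Empty)
open import Data.Unit using (⊤)
open import Relation.Binary.PropositionalEquality using (_≡_; _≢_)
open import Relation.Nullary using (¬_)
open import Function.Definitions using (Injective)

ℕ→ℚ : ℕ → ℚ
ℕ→ℚ n = (+ n) / 1

-- Raw tournaments on vertex set Fin n: adj x y ≡ true iff (x , y) is an edge.

Adj : ℕ → Set
Adj n = Fin n → Fin n → Bool

record IsTournament {n : ℕ} (adj : Adj n) : Set where
  field
    irrefl : ∀ x → adj x x ≡ false
    total  : ∀ x y → x ≢ y → adj x y ≡ not (adj y x)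

Path : ∀ {n} → Adj n → List (Fin n) → Set
Path adj [] = ⊤
Path adj (x ∷ []) = ⊤
Path adj (x ∷ y ∷ r) = (adj x y ≡ true) × Path adj (y ∷ r)

DirectedCycleIn : ∀ {n} → Adj n → Subset n → List (Fin n) → Set
DirectedCycleIn adj S [] = Empty
DirectedCycleIn adj S (x ∷ xs) =
  Unique (x ∷ xs) × All (_∈ S) (x ∷ xs) × Path adj ((x ∷ xs) ++ [ x ])

Transitive : ∀ {n} → Adj n → Subset n → Set
Transitive adj S = ∀ cyc → ¬ DirectedCycleIn adj S cyc

IsTr : ∀ {n} → Adj n → ℕ → Set
IsTr adj t = (Σ (Subset _) λ S → Transitive adj S × ∣ S ∣ ≡ t)
           × (∀ S → Transitive adj S → ∣ S ∣ ℕ.≤ t)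

Disjoint : ∀ {n} → Subset n → Subset n → Set
Disjoint X Y = ∀ x → x ∈ X → x ∈ Y → Empty

edges : ∀ {n} → Adj n → Subset n → Subset n → ℕ
edges {n} adj X Y =
  sum (map (λ x → sum (map (λ y →
    if lookup X x ∧ lookup Y y ∧ adj x y then 1 else 0) (allFin n))) (allFin n))

Complete : ∀ {n} → Adj n → Subset n → Subset n → Set
Complete adj X Y = ∀ x y → x ∈ X → y ∈ Y → adj x y ≡ true

-- d(X,Y) ≥ q, cross-multiplied: q·|X|·|Y| ≤ e_{X,Y}
DensityAtLeast : ∀ {n} → Adj n → Subset n → Subset n → ℚ → Set
DensityAtLeast adj X Y q = q ℚ.* ℕ→ℚ (∣ X ∣ ℕ.* ∣ Y ∣) ℚ.≤ ℕ→ℚ (edges adj X Y)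

DensityOne : ∀ {n} → Adj n → Subset n → Subset n → Set
DensityOne adj X Y = edges adj X Y ≡ ∣ X ∣ ℕ.* ∣ Y ∣

ones : ∀ {m} → Vec Bool m → ℕ
ones [] = 0
ones (true ∷ v) = suc (ones v)
ones (false ∷ v) = ones v

zeros : ∀ {m} → Vec Bool m → ℕ
zeros [] = 0
zeros (true ∷ v) = zeros v
zeros (false ∷ v) = suc (zeros v)

-- etaAt v η i = η(ζ^v(i)) when v(i) = 1 (and 1 when v(i) = 0, unused)
etaAt : ∀ {m} (v : Vec Bool m) → Vec ℕ (ones v) → Fin m → ℕ
etaAt (true ∷ v) (e ∷ η) zero = e
etaAt (true ∷ v) (e ∷ η) (suc i) = etaAt v η i
etaAt (false ∷ v) η zero = 1
etaAt (false ∷ v) η (suc i) = etaAt v η i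

kOf : ∀ {m} (v : Vec Bool m) → Vec ℕ (ones v) → ℕ
kOf v η = zeros v + Vec.sum η

width : ∀ {m} (v : Vec Bool m) → Vec ℕ (ones v) → Fin m → ℕ
width v η i = if lookup v i then etaAt v η i else 1

-- Candidate m-sequences: for each i, the pieces of S_i
-- (for v(i) = 1 the parts S_{i,1},…,S_{i,η(ζ^v(i))}; for v(i) = 0 just S_i)

record Seq (n : ℕ) {m : ℕ} (v : Vec Bool m) (η : Vec ℕ (ones v)) : Set where
  constructor mkSeq
  field
    pieces : (i : Fin m) → Vec (Subset n) (width v η i)
open Seq public

blockSet : ∀ {n m} {v : Vec Bool m} {η : Vec ℕ (ones v)} → Seq n v η → Fin m → Subset n
blockSet χ i = ⋃ (toList (pieces χ i))

long : ∀ {n m} {v : Vec Bool m} {η : Vec ℕ (ones v)} → Seq n v η → List (Subset n)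
long {m = m} χ = concatMap (λ i → toList (pieces χ i)) (allFin m)

nth : ∀ {n} → List (Subset n) → ℕ → Subset n
nth [] j = ⊥
nth (x ∷ xs) zero = x
nth (x ∷ xs) (suc j) = nth xs j

-- T_j (1-indexed, j ∈ {1,…,k})
longAt : ∀ {n m} {v : Vec Bool m} {η : Vec ℕ (ones v)} → Seq n v η → ℕ → Subset n
longAt χ j = nth (long χ) (j ∸ 1)

Vχ : ∀ {n m} {v : Vec Bool m} {η : Vec ℕ (ones v)} → Seq n v η → Subset n
Vχ χ = ⋃ (long χ)

record IsMSeq {n m : ℕ} (adj : Adj n) (t : ℕ) (v : Vec Bool m) (η : Vec ℕ (ones v))
              (c λ' : ℚ) (χ : Seq n v η) : Set where
  field
    disjoint      : ∀ i j → i ≢ j → Disjoint (blockSet χ i) (blockSet χ j)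
    plainBig      : ∀ i → lookup v i ≡ false →
                      c ℚ.* ℕ→ℚ n ℚ.≤ ℕ→ℚ ∣ blockSet χ i ∣
    transTrans    : ∀ i → lookup v i ≡ true → Transitive adj (blockSet χ i)
    partsDisjoint : ∀ i → lookup v i ≡ true → ∀ a b → a ≢ b →
                      Disjoint (lookup (pieces χ i) a) (lookup (pieces χ i) b)
    partsComplete : ∀ i → lookup v i ≡ true → ∀ a b → a Fin.< b →
                      Complete adj (lookup (pieces χ i) a) (lookup (pieces χ i) b)
    partsBig      : ∀ i → lookup v i ≡ true → ∀ a →
                      c ℚ.* ℕ→ℚ t ℚ.≤ ℕ→ℚ ∣ lookup (pieces χ i) a ∣
    dense         : ∀ i j → i Fin.< j →
                      DensityAtLeast adj (blockSet χ i) (blockSet χ j) (1ℚ ℚ.- λ')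

StrongPair : ∀ {n m} (adj : Adj n) (t : ℕ) {v : Vec Bool m} {η : Vec ℕ (ones v)} →
             ℚ → Seq n v η → Set
StrongPair {n} adj t c' χ = Σ (Subset n) λ A → Σ (Subset n) λ B →
    A ⊆ Vχ χ × B ⊆ Vχ χ × Disjoint A B
  × c' ℚ.* ℕ→ℚ n ℚ.≤ ℕ→ℚ ∣ A ∣
  × (c' ℚ.* ℕ→ℚ n ℚ.≤ ℕ→ℚ ∣ B ∣ ⊎ (Transitive adj B × c' ℚ.* ℕ→ℚ t ℚ.≤ ℕ→ℚ ∣ B ∣))
  × (DensityOne adj A B ⊎ DensityOne adj B A)

record Labelled : Set where
  field
    size : ℕ
    adj  : Adj size
    lab  : Fin size → ℕ
open Labelled public

Family : Set
Family = List Labelled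

Embeds : ∀ {n m} (adjT : Adj n) {v : Vec Bool m} {η : Vec ℕ (ones v)} →
         Seq n v η → Labelled → Set
Embeds {n} adjT χ H = Σ (Fin (size H) → Fin n) λ x →
    Injective _≡_ _≡_ x
  × (∀ a → x a ∈ longAt χ (lab H a))
  × (∀ a b → adjT (x a) (x b) ≡ adj H a b)

-- (F,v,η)-strong EH-property of a family (each member carries its f)
StrongEH : ∀ {m} (v : Vec Bool m) (η : Vec ℕ (ones v)) → Family → Set
StrongEH {m} v η ℋ =
    All (λ H → IsTournament (adj H)
             × Injective _≡_ _≡_ (lab H)
             × (∀ a → 1 ℕ.≤ lab H a × lab H a ℕ.≤ kOf v η)) ℋ
  × (∀ (c₁ : ℚ) → Positive c₁ →
       Σ ℚ λ λ₀ → Σ ℚ λ c₂ → Positive λ₀ × Positive c₂ ×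
       (∀ (n : ℕ) (adjT : Adj n) → IsTournament adjT → ∀ (t : ℕ) → IsTr adjT t →
        ∀ (λ' : ℚ) → NonNegative λ' → λ' ℚ.≤ λ₀ → λ' ℚ.< 1ℚ →
        ∀ (χ : Seq n v η) → IsMSeq adjT t v η c₁ λ' χ →
        Any (Embeds adjT χ) ℋ ⊎ StrongPair adjT t c₂ χ))

backward : (H : Labelled) → Fin (size H) → Fin (size H) → Bool
backward H x y = adj H x y ∧ (lab H y ℕ.<ᵇ lab H x)

-- vertex set V(H₁) ∪ V(H₂) represented as the disjoint union Fin (s₁ + s₂)
prodLab : (H₁ H₂ : Labelled) → Fin (size H₁ + size H₂) → ℕ
prodLab H₁ H₂ x with splitAt (size H₁) x
... | inj₁ a = lab H₁ a
... | inj₂ b = lab H₂ b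

prodBackward : (H₁ H₂ : Labelled) → Fin (size H₁ + size H₂) → Fin (size H₁ + size H₂) → Bool
prodBackward H₁ H₂ x y with splitAt (size H₁) x | splitAt (size H₁) y
... | inj₁ a | inj₁ b = backward H₁ a b
... | inj₂ a | inj₂ b = backward H₂ a b
... | _      | _      = false

-- the tournament whose backward edges under θ (increasing f₁ ⊕ f₂) are exactly prodBackward
prodAdj : (H₁ H₂ : Labelled) → Adj (size H₁ + size H₂)
prodAdj H₁ H₂ x y =
  if prodLab H₁ H₂ x ℕ.<ᵇ prodLab H₁ H₂ y
  then not (prodBackward H₁ H₂ y x)
  else prodBackward H₁ H₂ x y

_⊕_ : Labelled → Labelled → Labelled
H₁ ⊕ H₂ = record { size = size H₁ + size H₂ ; adj = prodAdj H₁ H₂ ; lab = prodLab H₁ H₂ }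

_⊕ᶠ_ : Family → Family → Family
ℋ₁ ⊕ᶠ ℋ₂ = cartesianProductWith _⊕_ ℋ₁ ℋ₂

Orthogonal : Family → Family → Set
Orthogonal ℋ₁ ℋ₂ = All (λ H₁ → All (λ H₂ →
  ∀ a b → lab H₁ a ≢ lab H₂ b) ℋ₂) ℋ₁

module Submission where

open import Defs
open import Data.Nat using (ℕ; _≤_)
open import Data.Bool using (Bool)
open import Data.Vec using (Vec; lookup)
open import Data.Fin using (Fin)
open import Data.Product using (_,_)

-- Given c₁ ≥ 1/N, apply both hypotheses with c = 1/(2N) and take λ₀
-- so small that, in an m-sequence χ with density at least 1 - λ₀, every part of
-- the long representation is nearly complete to every later part. By Markov's
-- inequality, at least half of each part is typical: misjoined to few vertices
-- of every other part. Restricted to the typical vertices, χ is still an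
-- m-sequence (with constants 1/(2N) and λ″), so it contains a copy of some
-- H₁ ∈ ℋ₁ or a strong pair, which is also one of χ. Restricting once more to the
-- vertices joined forward to the whole copy of H₁ again keeps half of each part;
-- there we find a copy of some H₂ ∈ ℋ₂ or a strong pair. All edges between the
-- two copies go forward in label order, so together they form a copy of H₁ ⊕ H₂.

module Counting where

  open import Data.Bool using (Bool; true; false; _∧_; if_then_else_)
  open import Data.Bool.Properties using (T-≡)
  open import Data.Fin using (Fin; zero; suc)
  open import Data.Fin.Properties using (all?; ¬∀⟶∃¬)
  open import Data.Fin.Subset using (Subset; _∈_; _∉_; _⊆_; ∣_∣; _∩_)
  open import Data.Fin.Subset.Properties using (_∈?_; x∈p∩q⁺)
  open import Data.List using (map; allFin)
  open import Data.List.Properties using (map-tabulate)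
  open import Data.Nat using (ℕ; zero; suc; _+_; _*_; _≤_; _<_; _<ᵇ_; _≡ᵇ_; z≤n; s≤s)
  open import Data.Nat.ListAction using () renaming (sum to listSum)
  open import Data.Nat.Properties
  open import Data.Nat.Tactic.RingSolver using (solve-∀)
  open import Data.Product using (∃; ∃₂; _,_)
  open import Data.Vec using ([]; _∷_; lookup; tabulate)
  open import Data.Vec.Properties using ([]=⇒lookup; lookup⇒[]=; lookup∘tabulate)
  open import Function using (_∘_)
  open import Function.Bundles using (Equivalence)
  open import Relation.Binary.PropositionalEquality
  open import Relation.Nullary using (¬_; Dec; yes; no; does; contradiction)
  open import Relation.Nullary.Decidable using (dec-true; decidable-stable; ¬?)
  open import Relation.Unary using (Decidable)
  open import Algebra.Properties.Semiring.Sum +-*-semiring public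
    using (sum; sum-syntax; ∑-distrib-+; ∑-comm; sum-cong-≗; sum-replicate-zero; *-distribˡ-sum; *-distribʳ-sum)

  ind : Bool → ℕ
  ind b = if b then 1 else 0

  ind-∧ : ∀ a b → ind (a ∧ b) ≡ ind a * ind b
  ind-∧ true b = sym (+-identityʳ (ind b))
  ind-∧ false b = refl

  ∧-trueˡ : ∀ {a b} → a ∧ b ≡ true → a ≡ true
  ∧-trueˡ {true} _ = refl

  ind-≤1 : ∀ b → ind b ≤ 1
  ind-≤1 true = ≤-refl
  ind-≤1 false = z≤n

  <ᵇ-true : ∀ {m n} → m < n → (m <ᵇ n) ≡ true
  <ᵇ-true m<n = Equivalence.to T-≡ (<⇒<ᵇ m<n)

  <ᵇ-false : ∀ {m n} → ¬ m < n → (m <ᵇ n) ≡ false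
  <ᵇ-false {m} {n} m≮n with m <ᵇ n in e
  ... | false = refl
  ... | true = contradiction (<ᵇ⇒< m n (Equivalence.from T-≡ e)) m≮n

  ≡ᵇ-true : ∀ m → (m ≡ᵇ m) ≡ true
  ≡ᵇ-true m = Equivalence.to T-≡ (≡⇒≡ᵇ m m refl)

  ≡ᵇ-false : ∀ {m n} → m ≢ n → (m ≡ᵇ n) ≡ false
  ≡ᵇ-false {m} {n} m≢n with m ≡ᵇ n in e
  ... | false = refl
  ... | true = contradiction (≡ᵇ⇒≡ m n (Equivalence.from T-≡ e)) m≢n

  ∑-mono-≤ : ∀ n {f g : Fin n → ℕ} → (∀ x → f x ≤ g x) → ∑[ x < n ] f x ≤ ∑[ x < n ] g x
  ∑-mono-≤ zero le = z≤n
  ∑-mono-≤ (suc n) le = +-mono-≤ (le zero) (∑-mono-≤ n (le ∘ suc))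

  ∑-point : ∀ n (f : Fin n → ℕ) x → f x ≤ ∑[ y < n ] f y
  ∑-point (suc n) f zero = m≤m+n _ _
  ∑-point (suc n) f (suc x) = ≤-trans (∑-point n (f ∘ suc) x) (m≤n+m _ _)

  ∑-const : ∀ n c → ∑[ x < n ] c ≡ n * c
  ∑-const zero c = refl
  ∑-const (suc n) c = cong (c +_) (∑-const n c)

  listSum-allFin : ∀ n (f : Fin n → ℕ) → listSum (map f (allFin n)) ≡ ∑[ x < n ] f x
  listSum-allFin n f = trans (cong listSum (map-tabulate (λ x → x) f)) (listSum-tabulate n f)
    where
    listSum-tabulate : ∀ n (f : Fin n → ℕ) → listSum (Data.List.tabulate f) ≡ ∑[ x < n ] f x
    listSum-tabulate zero f = refl
    listSum-tabulate (suc n) f = cong (f zero +_) (listSum-tabulate n (f ∘ suc))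

  ∈⇒lookup : ∀ {n} {p : Subset n} {x} → x ∈ p → lookup p x ≡ true
  ∈⇒lookup = []=⇒lookup

  ∉⇒lookup : ∀ {n} {p : Subset n} {x} → x ∉ p → lookup p x ≡ false
  ∉⇒lookup {p = p} {x} x∉p with lookup p x in e
  ... | true = contradiction (lookup⇒[]= x p e) x∉p
  ... | false = refl

  lookup⇒∈ : ∀ {n} {p : Subset n} {x} → lookup p x ≡ true → x ∈ p
  lookup⇒∈ {p = p} {x} = lookup⇒[]= x p

  card : ∀ {n} (p : Subset n) → ∣ p ∣ ≡ ∑[ x < n ] ind (lookup p x)
  card [] = refl
  card (true ∷ p) = cong suc (card p)
  card (false ∷ p) = card p

  ind-⊆ : ∀ {n} {p q : Subset n} → p ⊆ q → ∀ x → ind (lookup p x) ≤ ind (lookup q x)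
  ind-⊆ {p = p} {q} p⊆q x with lookup p x in e
  ... | false = z≤n
  ... | true rewrite ∈⇒lookup (p⊆q (lookup⇒∈ e)) = ≤-refl

  card-empty : ∀ {n} (p : Subset n) → (∀ x → lookup p x ≡ false) → ∣ p ∣ ≡ 0
  card-empty {n} p none = begin
    ∣ p ∣                          ≡⟨ card p ⟩
    ∑[ x < n ] ind (lookup p x)    ≡⟨ sum-cong-≗ (λ x → cong ind (none x)) ⟩
    ∑[ x < n ] 0                   ≡⟨ sum-replicate-zero n ⟩
    0                              ∎
    where open ≡-Reasoning

  markovSet : ∀ {n} → Subset n → (Fin n → ℕ) → ℕ → ℕ → Subset n
  markovSet X g D K = tabulate (λ x → lookup X x ∧ (D <ᵇ K * g x))

  markov : ∀ {n} (X : Subset n) (g : Fin n → ℕ) D K →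
    ∣ markovSet X g D K ∣ * suc D ≤ K * ∑[ x < n ] (ind (lookup X x) * g x)
  markov {n} X g D K = begin
    ∣ markovSet X g D K ∣ * suc D                           ≡⟨ cong (_* suc D) (card (markovSet X g D K)) ⟩
    (∑[ x < n ] ind (lookup (markovSet X g D K) x)) * suc D ≡⟨ *-distribʳ-sum (suc D) (λ x → ind (lookup (markovSet X g D K) x)) ⟩
    ∑[ x < n ] (ind (lookup (markovSet X g D K) x) * suc D) ≤⟨ ∑-mono-≤ n termwise ⟩
    ∑[ x < n ] (K * (ind (lookup X x) * g x))               ≡⟨ sym (*-distribˡ-sum K (λ x → ind (lookup X x) * g x)) ⟩
    K * ∑[ x < n ] (ind (lookup X x) * g x)                 ∎
    where
    open ≤-Reasoning
    termwise : ∀ x → ind (lookup (markovSet X g D K) x) * suc D ≤ K * (ind (lookup X x) * g x)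
    termwise x rewrite lookup∘tabulate (λ x → lookup X x ∧ (D <ᵇ K * g x)) x
      with lookup X x | D <ᵇ K * g x in big
    ... | false | _ = z≤n
    ... | true | false = z≤n
    ... | true | true = begin
      1 * suc D     ≡⟨ *-identityˡ (suc D) ⟩
      suc D         ≤⟨ <ᵇ⇒< D (K * g x) (Equivalence.from T-≡ big) ⟩
      K * g x       ≡⟨ cong (K *_) (sym (*-identityˡ (g x))) ⟩
      K * (1 * g x) ∎

  markovSet⊆ : ∀ {n} (X : Subset n) g D K → markovSet X g D K ⊆ X
  markovSet⊆ X g D K {x} x∈ = lookup⇒∈ (∧-trueˡ (trans (sym (lookup∘tabulate _ x)) (∈⇒lookup x∈)))

  markovSet-∉ : ∀ {n} (X : Subset n) g D K {x} → x ∈ X → x ∉ markovSet X g D K → K * g x ≤ D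
  markovSet-∉ X g D K {x} x∈X x∉ with D <ᵇ K * g x in big
  ... | false = ≮⇒≥ (λ D<Kg → contradiction (trans (sym (<ᵇ-true D<Kg)) big) λ ())
  ... | true = contradiction (lookup⇒∈ member) x∉
    where
    member : lookup (markovSet X g D K) x ≡ true
    member rewrite lookup∘tabulate (λ x → lookup X x ∧ (D <ᵇ K * g x)) x | ∈⇒lookup x∈X | big = refl

  select : ∀ {n} {P : Fin n → Set} → Decidable P → Subset n
  select P? = tabulate (λ x → does (P? x))

  select⁺ : ∀ {n} {P : Fin n → Set} (P? : Decidable P) {x} → P x → x ∈ select P?
  select⁺ P? {x} px = lookup⇒∈ (trans (lookup∘tabulate _ x) (dec-true (P? x) px))

  select⁻ : ∀ {n} {P : Fin n → Set} (P? : Decidable P) {x} → x ∈ select P? → P x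
  select⁻ P? {x} x∈ with P? x | trans (sym (lookup∘tabulate (λ x → does (P? x)) x)) (∈⇒lookup x∈)
  ... | yes px | _ = px
  ... | no _ | ()

  cover : ∀ {n k} (A R : Subset n) (B : Fin k → Subset n) →
    (∀ {x} → x ∈ A → x ∉ R → ∃ λ l → x ∈ B l) →
    ∣ A ∣ ≤ ∣ A ∩ R ∣ + ∑[ l < k ] ∣ B l ∣
  cover {n} {k} A R B covered = begin
    ∣ A ∣                                                      ≡⟨ card A ⟩
    ∑[ x < n ] ind (lookup A x)                                ≤⟨ ∑-mono-≤ n pointwise ⟩
    ∑[ x < n ] (ind (lookup (A ∩ R) x) + ∑[ l < k ] inB l x)   ≡⟨ ∑-distrib-+ (λ x → ind (lookup (A ∩ R) x)) (λ x → ∑[ l < k ] inB l x) ⟩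
    ∑[ x < n ] ind (lookup (A ∩ R) x) + ∑[ x < n ] ∑[ l < k ] inB l x
                                        ≡⟨ cong₂ _+_ (sym (card (A ∩ R))) (∑-comm (λ x l → inB l x)) ⟩
    ∣ A ∩ R ∣ + ∑[ l < k ] ∑[ x < n ] inB l x                  ≡⟨ cong (∣ A ∩ R ∣ +_) (sum-cong-≗ (λ l → sym (card (B l)))) ⟩
    ∣ A ∩ R ∣ + ∑[ l < k ] ∣ B l ∣                             ∎
    where
    open ≤-Reasoning
    inB : Fin k → Fin n → ℕ
    inB l x = ind (lookup (B l) x)
    pointwise : ∀ x → ind (lookup A x) ≤ ind (lookup (A ∩ R) x) + ∑[ l < k ] inB l x
    pointwise x with x ∈? A | x ∈? R
    ... | no x∉A | _ rewrite ∉⇒lookup x∉A = z≤n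
    ... | yes x∈A | yes x∈R rewrite ∈⇒lookup x∈A | ∈⇒lookup (x∈p∩q⁺ (x∈A , x∈R)) = s≤s z≤n
    ... | yes x∈A | no x∉R with covered x∈A x∉R
    ...   | l , x∈Bl = ≤-trans (ind-≤1 (lookup A x))
                         (≤-trans (≤-reflexive (sym (cong ind (∈⇒lookup x∈Bl))))
                           (≤-trans (∑-point k (λ l → inB l x) l) (m≤n+m _ _)))

  cover-half : ∀ {n k} (A R : Subset n) (B : Fin k → Subset n) →
    (∀ {x} → x ∈ A → x ∉ R → ∃ λ l → x ∈ B l) →
    2 * ∑[ l < k ] ∣ B l ∣ ≤ ∣ A ∣ → ∣ A ∣ ≤ 2 * ∣ A ∩ R ∣
  cover-half A R B covered small = half {b = ∑[ l < _ ] ∣ B l ∣} (cover A R B covered) small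
    where
    half : ∀ {t a b} → t ≤ a + b → 2 * b ≤ t → t ≤ 2 * a
    half {t} {a} {b} t≤a+b 2b≤t = +-cancelʳ-≤ t t (2 * a) (begin
      t + t                ≤⟨ +-mono-≤ t≤a+b t≤a+b ⟩
      (a + b) + (a + b)    ≡⟨ regroup a b ⟩
      2 * a + 2 * b        ≤⟨ +-monoʳ-≤ (2 * a) 2b≤t ⟩
      2 * a + t            ∎)
      where
      open ≤-Reasoning
      regroup : ∀ a b → (a + b) + (a + b) ≡ 2 * a + 2 * b
      regroup = solve-∀

  avoids? : ∀ {n h k} (S : Fin h → Fin k → Subset n) y → Dec (∀ a b → y ∉ S a b)
  avoids? S y = all? λ a → all? λ b → ¬? (y ∈? S a b)

  avoiding : ∀ {n h k} → (Fin h → Fin k → Subset n) → Subset n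
  avoiding S = select (avoids? S)

  avoiding⁻ : ∀ {n h k} (S : Fin h → Fin k → Subset n) {y} → y ∈ avoiding S → ∀ a b → y ∉ S a b
  avoiding⁻ S = select⁻ (avoids? S)

  avoiding-∉ : ∀ {n h k} (S : Fin h → Fin k → Subset n) {y} → y ∉ avoiding S → ∃₂ λ a b → y ∈ S a b
  avoiding-∉ {h = h} {k} S {y} y∉ with ¬∀⟶∃¬ h _ (λ a → all? λ b → ¬? (y ∈? S a b)) (y∉ ∘ select⁺ (avoids? S))
  ... | a , ¬all with ¬∀⟶∃¬ k _ (λ b → ¬? (y ∈? S a b)) ¬all
  ...   | b , ¬¬y∈ = a , b , decidable-stable (y ∈? S a b) ¬¬y∈

module NonEdges where

  open import Data.Bool using (true; false; _∧_; not)
  open import Data.Fin using (Fin)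
  open import Data.Fin.Subset as Sub using (Subset; _⊆_; ∣_∣)
  open import Data.Fin.Subset.Properties using (∣⊥∣≡0)
  open import Data.List using (map; allFin)
  open import Data.Nat using (ℕ; _+_; _*_; _≤_)
  open import Data.Nat.ListAction using () renaming (sum to listSum)
  open import Data.Nat.Properties
  open import Data.Vec using (lookup)
  open import Relation.Binary.PropositionalEquality
  open import Defs using (Adj; edges; Complete)
  open Counting

  module _ {n : ℕ} (adj : Adj n) where

    E NE : Subset n → Subset n → ℕ
    E X Y = ∑[ x < n ] ∑[ y < n ] ind (lookup X x ∧ lookup Y y ∧ adj x y)
    NE X Y = ∑[ x < n ] ∑[ y < n ] ind (lookup X x ∧ lookup Y y ∧ not (adj x y))

    edges≡E : ∀ X Y → edges adj X Y ≡ E X Y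
    edges≡E X Y = trans (listSum-allFin n (λ x → listSum (map (edge x) (allFin n))))
                        (sum-cong-≗ (λ x → listSum-allFin n (edge x)))
      where
      edge : Fin n → Fin n → ℕ
      edge x y = ind (lookup X x ∧ lookup Y y ∧ adj x y)

    E+NE : ∀ X Y → E X Y + NE X Y ≡ ∣ X ∣ * ∣ Y ∣
    E+NE X Y = begin
      E X Y + NE X Y
        ≡⟨ sym (∑-distrib-+ (λ x → ∑[ y < n ] hit x y) (λ x → ∑[ y < n ] miss x y)) ⟩
      ∑[ x < n ] (∑[ y < n ] hit x y + ∑[ y < n ] miss x y)
        ≡⟨ sum-cong-≗ (λ x → sym (∑-distrib-+ (hit x) (miss x))) ⟩
      ∑[ x < n ] ∑[ y < n ] (hit x y + miss x y)
        ≡⟨ sum-cong-≗ (λ x → sum-cong-≗ (λ y → split (lookup X x) (lookup Y y) (adj x y))) ⟩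
      ∑[ x < n ] ∑[ y < n ] (ind (lookup X x) * ind (lookup Y y))
        ≡⟨ sum-cong-≗ (λ x → sym (*-distribˡ-sum (ind (lookup X x)) (λ y → ind (lookup Y y)))) ⟩
      ∑[ x < n ] (ind (lookup X x) * ∑[ y < n ] ind (lookup Y y))
        ≡⟨ sym (*-distribʳ-sum (∑[ y < n ] ind (lookup Y y)) (λ x → ind (lookup X x))) ⟩
      (∑[ x < n ] ind (lookup X x)) * ∑[ y < n ] ind (lookup Y y)
        ≡⟨ sym (cong₂ _*_ (card X) (card Y)) ⟩
      ∣ X ∣ * ∣ Y ∣ ∎
      where
      open ≡-Reasoning
      hit miss : Fin n → Fin n → ℕ
      hit x y = ind (lookup X x ∧ lookup Y y ∧ adj x y)
      miss x y = ind (lookup X x ∧ lookup Y y ∧ not (adj x y))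
      split : ∀ a b c → ind (a ∧ b ∧ c) + ind (a ∧ b ∧ not c) ≡ ind a * ind b
      split true true true = refl
      split true true false = refl
      split true false c = refl
      split false b c = refl

    NE≤ : ∀ X Y → NE X Y ≤ ∣ X ∣ * ∣ Y ∣
    NE≤ X Y = subst (NE X Y ≤_) (E+NE X Y) (m≤n+m (NE X Y) (E X Y))

    NE-⊥ : ∀ X → NE X Sub.⊥ ≡ 0
    NE-⊥ X = n≤0⇒n≡0 (≤-trans (NE≤ X Sub.⊥) (≤-reflexive (trans (cong (∣ X ∣ *_) (∣⊥∣≡0 n)) (*-zeroʳ ∣ X ∣))))

    NE-mono : ∀ {X X' Y Y'} → X' ⊆ X → Y' ⊆ Y → NE X' Y' ≤ NE X Y
    NE-mono {X} {X'} {Y} {Y'} X'⊆X Y'⊆Y = ∑-mono-≤ n λ x → ∑-mono-≤ n λ y →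
      subst₂ _≤_ (sym (factor X' Y' x y)) (sym (factor X Y x y))
        (*-monoˡ-≤ (ind (not (adj x y))) (*-mono-≤ (ind-⊆ X'⊆X x) (ind-⊆ Y'⊆Y y)))
      where
      factor : ∀ A B x y → ind (lookup A x ∧ lookup B y ∧ not (adj x y)) ≡
                           ind (lookup A x) * ind (lookup B y) * ind (not (adj x y))
      factor A B x y = begin
        ind (lookup A x ∧ lookup B y ∧ not (adj x y))
          ≡⟨ ind-∧ (lookup A x) _ ⟩
        ind (lookup A x) * ind (lookup B y ∧ not (adj x y))
          ≡⟨ cong (ind (lookup A x) *_) (ind-∧ (lookup B y) _) ⟩
        ind (lookup A x) * (ind (lookup B y) * ind (not (adj x y)))
          ≡⟨ sym (*-assoc (ind (lookup A x)) _ _) ⟩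
        ind (lookup A x) * ind (lookup B y) * ind (not (adj x y)) ∎
        where open ≡-Reasoning

    NE-complete : ∀ X Y → Complete adj X Y → NE X Y ≡ 0
    NE-complete X Y complete = begin
      NE X Y                 ≡⟨ sum-cong-≗ (λ x → trans (sum-cong-≗ (none x)) (sum-replicate-zero n)) ⟩
      ∑[ x < n ] 0           ≡⟨ sum-replicate-zero n ⟩
      0                      ∎
      where
      open ≡-Reasoning
      none : ∀ x y → ind (lookup X x ∧ lookup Y y ∧ not (adj x y)) ≡ 0
      none x y with lookup X x in x∈X | lookup Y y in y∈Y
      ... | false | _ = refl
      ... | true | false = refl
      ... | true | true rewrite complete x y (lookup⇒∈ x∈X) (lookup⇒∈ y∈Y) = refl

    outMisses : Subset n → Fin n → ℕ
    outMisses Y x = ∑[ y < n ] ind (lookup Y y ∧ not (adj x y))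

    inMisses : Subset n → Fin n → ℕ
    inMisses X y = ∑[ x < n ] ind (lookup X x ∧ not (adj x y))

    NE-byRows : ∀ X Y → NE X Y ≡ ∑[ x < n ] (ind (lookup X x) * outMisses Y x)
    NE-byRows X Y = sum-cong-≗ {n} λ x →
      trans (sum-cong-≗ {n} (λ y → ind-∧ (lookup X x) _))
            (sym (*-distribˡ-sum (ind (lookup X x)) (λ y → ind (lookup Y y ∧ not (adj x y)))))

    NE-byColumns : ∀ X Y → NE X Y ≡ ∑[ y < n ] (ind (lookup Y y) * inMisses X y)
    NE-byColumns X Y = begin
      NE X Y
        ≡⟨ sum-cong-≗ (λ x → sum-cong-≗ (λ y → swap (lookup X x) (lookup Y y) (adj x y))) ⟩
      ∑[ x < n ] ∑[ y < n ] term x y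
        ≡⟨ ∑-comm term ⟩
      ∑[ y < n ] ∑[ x < n ] term x y
        ≡⟨ sum-cong-≗ (λ y → sym (*-distribˡ-sum (ind (lookup Y y)) (λ x → ind (lookup X x ∧ not (adj x y))))) ⟩
      ∑[ y < n ] (ind (lookup Y y) * inMisses X y) ∎
      where
      open ≡-Reasoning
      term : Fin n → Fin n → ℕ
      term x y = ind (lookup Y y) * ind (lookup X x ∧ not (adj x y))
      swap : ∀ a b c → ind (a ∧ b ∧ not c) ≡ ind b * ind (a ∧ not c)
      swap true true c = sym (+-identityʳ _)
      swap true false c = refl
      swap false true c = refl
      swap false false c = refl

module Cleaning where

  open import Data.Bool using (Bool; true; false; _∧_; if_then_else_; not)
  open import Data.Bool.Properties using (∧-zeroʳ)
  open import Data.Fin using (Fin; toℕ)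
  open import Data.Fin.Properties using (toℕ-injective)
  open import Data.Fin.Subset using (Subset; _∈_; _∉_; _⊆_; ∣_∣; _∩_)
  open import Data.Nat using (ℕ; suc; _*_; _≤_; _<_; _<ᵇ_; _≡ᵇ_; z≤n; s≤s; NonZero)
  open import Data.Nat.Properties
  open import Data.Nat.Tactic.RingSolver using (solve-∀)
  open import Data.Product using (∃; _,_)
  open import Data.Vec using (lookup; tabulate)
  open import Data.Vec.Properties using (lookup∘tabulate)
  open import Relation.Binary using (tri<; tri≈; tri>)
  open import Relation.Binary.PropositionalEquality
  open import Relation.Nullary using (yes; no; contradiction)
  open import Defs using (Adj; Disjoint)
  open Counting
  open NonEdges

  module InParts {n : ℕ} (adj : Adj n) (T : ℕ → Subset n)
                 (parts-disjoint : ∀ j l → j ≢ l → Disjoint (T j) (T l)) where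

    NearlyComplete : ℕ → ℕ → Set
    NearlyComplete M L = ∀ j l → j < l → L * NE adj (T j) (T l) ≤ M * (∣ T j ∣ * ∣ T l ∣)

    same-part : ∀ {j l x} → x ∈ T j → x ∈ T l → j ≡ l
    same-part {j} {l} {x} x∈j x∈l with j ≟ l
    ... | yes j≡l = j≡l
    ... | no j≢l = contradiction x∈l (parts-disjoint j l j≢l x x∈j)

    forward : ℕ → ℕ → Fin n → Fin n → Bool
    forward j l u w = if j <ᵇ l then adj u w else adj w u

    misjoined : Fin n → ℕ → ℕ → Subset n
    misjoined x j l = tabulate (λ y → lookup (T l) y ∧ not (j ≡ᵇ l) ∧ not (forward j l x y))

    misjoined-lookup : ∀ x j l y →
      lookup (misjoined x j l) y ≡ (lookup (T l) y ∧ not (j ≡ᵇ l) ∧ not (forward j l x y))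
    misjoined-lookup x j l y = lookup∘tabulate _ y

    misjoined⊆ : ∀ x j l → misjoined x j l ⊆ T l
    misjoined⊆ x j l {y} y∈ = lookup⇒∈ (∧-trueˡ (trans (sym (misjoined-lookup x j l y)) (∈⇒lookup y∈)))

    not-misjoined : ∀ {x j l y} → j ≢ l → y ∈ T l → y ∉ misjoined x j l → forward j l x y ≡ true
    not-misjoined {x} {j} {l} {y} j≢l y∈T y∉ with forward j l x y in backward
    ... | true = refl
    ... | false = contradiction (lookup⇒∈ member) y∉
      where
      member : lookup (misjoined x j l) y ≡ true
      member rewrite misjoined-lookup x j l y | ∈⇒lookup y∈T | ≡ᵇ-false j≢l | backward = refl

    ∣misjoined∣ : ∀ x j l →
      ∣ misjoined x j l ∣ ≡ ∑[ y < n ] ind (lookup (T l) y ∧ not (j ≡ᵇ l) ∧ not (forward j l x y))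
    ∣misjoined∣ x j l = trans (card (misjoined x j l)) (sum-cong-≗ {n} (λ y → cong ind (misjoined-lookup x j l y)))

    misjoined-< : ∀ {j l} x → j < l → ∣ misjoined x j l ∣ ≡ outMisses adj (T l) x
    misjoined-< {j} {l} x j<l rewrite ∣misjoined∣ x j l | ≡ᵇ-false (<⇒≢ j<l) | <ᵇ-true j<l = refl

    misjoined-> : ∀ {j l} x → l < j → ∣ misjoined x j l ∣ ≡ inMisses adj (T l) x
    misjoined-> {j} {l} x l<j rewrite ∣misjoined∣ x j l | ≡ᵇ-false (>⇒≢ l<j) | <ᵇ-false (<⇒≯ l<j) = refl

    misjoined-≡ : ∀ x j → ∣ misjoined x j j ∣ ≡ 0
    misjoined-≡ x j = card-empty (misjoined x j j) none
      where
      none : ∀ y → lookup (misjoined x j j) y ≡ false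
      none y rewrite misjoined-lookup x j j y | ≡ᵇ-true j = ∧-zeroʳ (lookup (T j) y)

    -- Then, summed over x ∈ T j, few vertices of T l are misjoined to x: the
    -- misjoined pairs are exactly the non-edges from the earlier part to the later.
    misjoined-total : ∀ (M L : ℕ) → NearlyComplete M L →
      ∀ j l → L * ∑[ x < n ] (ind (lookup (T j) x) * ∣ misjoined x j l ∣) ≤ M * (∣ T j ∣ * ∣ T l ∣)
    misjoined-total M L sparse j l with <-cmp j l
    ... | tri< j<l _ _ = subst (λ s → L * s ≤ M * (∣ T j ∣ * ∣ T l ∣)) rows (sparse j l j<l)
      where
      rows : NE adj (T j) (T l) ≡ ∑[ x < n ] (ind (lookup (T j) x) * ∣ misjoined x j l ∣)
      rows = trans (NE-byRows adj (T j) (T l))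
                   (sum-cong-≗ (λ x → cong (ind (lookup (T j) x) *_) (sym (misjoined-< x j<l))))
    ... | tri≈ _ refl _ = ≤-trans (≤-reflexive (trans (cong (L *_) nothing) (*-zeroʳ L))) z≤n
      where
      nothing : ∑[ x < n ] (ind (lookup (T j) x) * ∣ misjoined x j j ∣) ≡ 0
      nothing = trans (sum-cong-≗ (λ x → trans (cong (ind (lookup (T j) x) *_) (misjoined-≡ x j))
                                                (*-zeroʳ (ind (lookup (T j) x)))))
                      (sum-replicate-zero n)
    ... | tri> _ _ l<j = subst₂ (λ s p → L * s ≤ M * p) columns (*-comm ∣ T l ∣ ∣ T j ∣) (sparse l j l<j)
      where
      columns : NE adj (T l) (T j) ≡ ∑[ x < n ] (ind (lookup (T j) x) * ∣ misjoined x j l ∣)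
      columns = trans (NE-byColumns adj (T l) (T j))
                      (sum-cong-≗ (λ x → cong (ind (lookup (T j) x) *_) (sym (misjoined-> x l<j))))

    -- First cleaning: a vertex of T j is typical if, for each l, it is
    -- misjoined to at most a 1/(4W) fraction of T l.
    module Typical (K W : ℕ) where

      misjoinedTo : Fin K → Fin K → Fin n → ℕ
      misjoinedTo j l x = ∣ misjoined x (toℕ j) (toℕ l) ∣

      atypical : Fin K → Fin K → Subset n
      atypical j l = markovSet (T (toℕ j)) (misjoinedTo j l) ∣ T (toℕ l) ∣ (4 * W)

      typical : Subset n
      typical = avoiding atypical

      typical-few : ∀ {x} → x ∈ typical → ∀ {j} → x ∈ T (toℕ j) →
        ∀ l → 4 * W * ∣ misjoined x (toℕ j) (toℕ l) ∣ ≤ ∣ T (toℕ l) ∣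
      typical-few x∈ {j} x∈T l =
        markovSet-∉ (T (toℕ j)) (misjoinedTo j l) ∣ T (toℕ l) ∣ (4 * W) x∈T (avoiding⁻ atypical x∈ j l)

      atypical-small : ∀ M L → NearlyComplete M L →
        ∀ j l → ∣ atypical j l ∣ * L ≤ 4 * W * M * ∣ T (toℕ j) ∣
      atypical-small M L sparse j l = *-cancelʳ-≤ _ _ (suc tₗ) (begin
        ∣ atypical j l ∣ * L * suc tₗ   ≡⟨ swap-last ∣ atypical j l ∣ L (suc tₗ) ⟩
        L * (∣ atypical j l ∣ * suc tₗ) ≤⟨ *-monoʳ-≤ L (markov (T (toℕ j)) (misjoinedTo j l) tₗ (4 * W)) ⟩
        L * (4 * W * total)             ≡⟨ swap-first L (4 * W) total ⟩
        4 * W * (L * total)             ≤⟨ *-monoʳ-≤ (4 * W) (misjoined-total M L sparse (toℕ j) (toℕ l)) ⟩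
        4 * W * (M * (tⱼ * tₗ))         ≤⟨ *-monoʳ-≤ (4 * W) (*-monoʳ-≤ M (*-monoʳ-≤ tⱼ (n≤1+n tₗ))) ⟩
        4 * W * (M * (tⱼ * suc tₗ))     ≡⟨ regroup (4 * W) M tⱼ (suc tₗ) ⟩
        4 * W * M * tⱼ * suc tₗ         ∎)
        where
        open ≤-Reasoning
        tⱼ tₗ total : ℕ
        tⱼ = ∣ T (toℕ j) ∣
        tₗ = ∣ T (toℕ l) ∣
        total = ∑[ x < n ] (ind (lookup (T (toℕ j)) x) * misjoinedTo j l x)
        swap-last : ∀ a b c → a * b * c ≡ b * (a * c)
        swap-last = solve-∀
        swap-first : ∀ a b c → a * (b * c) ≡ b * (a * c)
        swap-first = solve-∀
        regroup : ∀ a b c d → a * (b * (c * d)) ≡ a * b * c * d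
        regroup = solve-∀

      typical-large : ∀ M L .{{_ : NonZero L}} → NearlyComplete M L →
        2 * (K * (4 * W * M)) ≤ L → ∀ j → ∣ T (toℕ j) ∣ ≤ 2 * ∣ T (toℕ j) ∩ typical ∣
      typical-large M L sparse enough j = cover-half (T (toℕ j)) typical (atypical j) covered small
        where
        covered : ∀ {x} → x ∈ T (toℕ j) → x ∉ typical → ∃ λ l → x ∈ atypical j l
        covered x∈T x∉ with avoiding-∉ atypical x∉
        ... | j' , l , x∈A
          with toℕ-injective (same-part (markovSet⊆ (T (toℕ j')) (misjoinedTo j' l) ∣ T (toℕ l) ∣ (4 * W) x∈A) x∈T)
        ...   | refl = l , x∈A
        small : 2 * ∑[ l < K ] ∣ atypical j l ∣ ≤ ∣ T (toℕ j) ∣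
        small = *-cancelʳ-≤ _ _ L (begin
          2 * ∑[ l < K ] ∣ atypical j l ∣ * L    ≡⟨ *-assoc 2 (∑[ l < K ] ∣ atypical j l ∣) L ⟩
          2 * (∑[ l < K ] ∣ atypical j l ∣ * L)  ≡⟨ cong (2 *_) (*-distribʳ-sum L (λ l → ∣ atypical j l ∣)) ⟩
          2 * ∑[ l < K ] (∣ atypical j l ∣ * L)  ≤⟨ *-monoʳ-≤ 2 (∑-mono-≤ K (atypical-small M L sparse j)) ⟩
          2 * ∑[ l < K ] (4 * W * M * ∣ T (toℕ j) ∣) ≡⟨ cong (2 *_) (∑-const K _) ⟩
          2 * (K * (4 * W * M * ∣ T (toℕ j) ∣))  ≡⟨ regroup K (4 * W * M) ∣ T (toℕ j) ∣ ⟩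
          2 * (K * (4 * W * M)) * ∣ T (toℕ j) ∣  ≤⟨ *-monoˡ-≤ _ enough ⟩
          L * ∣ T (toℕ j) ∣                      ≡⟨ *-comm L _ ⟩
          ∣ T (toℕ j) ∣ * L                      ∎)
          where
          open ≤-Reasoning
          regroup : ∀ k c t → 2 * (k * (c * t)) ≡ 2 * (k * c) * t
          regroup = solve-∀

    -- Second cleaning: given vertices x a ∈ T (pos a), keep the vertices y
    -- joined forward to every x a (unless y lies in the part of x a).
    module Compatible (K W : ℕ) {h : ℕ} (x : Fin h → Fin n) (pos : Fin h → Fin K) where
      open Typical K W using (typical; typical-few)

      misjoinedFrom : Fin h → Fin K → Subset n
      misjoinedFrom a l = misjoined (x a) (toℕ (pos a)) (toℕ l)

      compatible : Subset n
      compatible = avoiding misjoinedFrom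

      compatible-forward : ∀ {y} → y ∈ compatible → ∀ a l → y ∈ T (toℕ l) → toℕ (pos a) ≢ toℕ l →
        forward (toℕ (pos a)) (toℕ l) (x a) y ≡ true
      compatible-forward y∈ a l y∈T ne =
        not-misjoined ne y∈T (avoiding⁻ misjoinedFrom y∈ a l)

      compatible-large : h ≤ W → .{{_ : NonZero W}} →
        (∀ a → x a ∈ T (toℕ (pos a))) → (∀ a → x a ∈ typical) →
        ∀ l → ∣ T (toℕ l) ∣ ≤ 2 * ∣ T (toℕ l) ∩ compatible ∣
      compatible-large h≤W x∈T x-typical l = cover-half (T (toℕ l)) compatible wrongFor covered small
        where
        wrongFor : Fin h → Subset n
        wrongFor a = misjoinedFrom a l
        covered : ∀ {y} → y ∈ T (toℕ l) → y ∉ compatible → ∃ λ a → y ∈ wrongFor a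
        covered y∈T y∉ with avoiding-∉ misjoinedFrom y∉
        ... | a , l' , y∈W with toℕ-injective (same-part (misjoined⊆ (x a) (toℕ (pos a)) (toℕ l') y∈W) y∈T)
        ...   | refl = a , y∈W
        quarter : W * (4 * ∑[ a < h ] ∣ wrongFor a ∣) ≤ W * ∣ T (toℕ l) ∣
        quarter = begin
          W * (4 * ∑[ a < h ] ∣ wrongFor a ∣)    ≡⟨ regroup W (∑[ a < h ] ∣ wrongFor a ∣) ⟩
          4 * W * ∑[ a < h ] ∣ wrongFor a ∣      ≡⟨ *-distribˡ-sum (4 * W) (λ a → ∣ wrongFor a ∣) ⟩
          ∑[ a < h ] (4 * W * ∣ wrongFor a ∣)    ≤⟨ ∑-mono-≤ h (λ a → typical-few (x-typical a) (x∈T a) l) ⟩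
          ∑[ a < h ] ∣ T (toℕ l) ∣               ≡⟨ ∑-const h ∣ T (toℕ l) ∣ ⟩
          h * ∣ T (toℕ l) ∣                      ≤⟨ *-monoˡ-≤ _ h≤W ⟩
          W * ∣ T (toℕ l) ∣                      ∎
          where
          open ≤-Reasoning
          regroup : ∀ w s → w * (4 * s) ≡ 4 * w * s
          regroup = solve-∀
        small : 2 * ∑[ a < h ] ∣ wrongFor a ∣ ≤ ∣ T (toℕ l) ∣
        small = ≤-trans (*-monoˡ-≤ (∑[ a < h ] ∣ wrongFor a ∣) (s≤s (s≤s (z≤n {2})))) (*-cancelˡ-≤ W quarter)

module Pieces where

  open import Data.Bool using (Bool; true; false; if_then_else_)
  open import Data.Fin as Fin using (Fin; zero; suc; toℕ; fromℕ<)
  open import Data.Fin.Properties using (toℕ-fromℕ<)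
  open import Data.Fin.Subset as Sub using (Subset; _∈_)
  open import Data.Fin.Subset.Properties using (∉⊥)
  open import Data.List as List using (List; []; _∷_; map; allFin; concatMap; _++_; length)
  open import Data.List.Membership.Propositional using () renaming (_∈_ to _∈ₗ_)
  open import Data.List.Membership.Propositional.Properties using (∈-concatMap⁺; ∈-map⁺; ∈-allFin; ∈-lookup)
  open import Data.List.Properties using (map-tabulate; map-++; map-∘)
  open import Data.List.Relation.Unary.All as All using (All)
  import Data.List.Relation.Unary.All.Properties as AllP
  open import Data.List.Relation.Unary.AllPairs as AllPairs using (AllPairs; _∷_)
  import Data.List.Relation.Unary.AllPairs.Properties as AllPairsP
  open import Data.List.Relation.Unary.Any as Any using ()
  open import Data.List.Relation.Unary.Any.Properties using (lookup-index)
  open import Data.Nat as ℕ using (ℕ; zero; suc; _≤_; _<_; z≤n; s≤s)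
  open import Data.Nat.Properties using (_<?_; ≮⇒≥)
  open import Data.Product using (Σ; _×_; _,_)
  open import Data.Sum using (_⊎_; inj₁; inj₂)
  open import Data.Vec as Vec using (Vec; []; _∷_; toList)
  open import Relation.Binary.PropositionalEquality
  open import Relation.Nullary using (yes; no; contradiction)
  open import Defs

  AllPairs-lookup : ∀ {A : Set} {R : A → A → Set} {xs : List A} → AllPairs R xs →
    ∀ {i j : Fin (length xs)} → i Fin.< j → R (List.lookup xs i) (List.lookup xs j)
  AllPairs-lookup (first ∷ _) {zero} {suc j} _ = All.lookup first (∈-lookup j)
  AllPairs-lookup (_ ∷ rest) {suc i} {suc j} i<j = AllPairs-lookup rest (ℕ.s≤s⁻¹ i<j)

  nth-map-lookup : ∀ {n} {A : Set} (f : A → Subset n) (xs : List A) (j : Fin (length xs)) →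
    nth (map f xs) (toℕ j) ≡ f (List.lookup xs j)
  nth-map-lookup f (x ∷ xs) zero = refl
  nth-map-lookup f (x ∷ xs) (suc j) = nth-map-lookup f xs j

  nth-map-beyond : ∀ {n} {A : Set} (f : A → Subset n) (xs : List A) j →
    length xs ≤ j → nth (map f xs) j ≡ Sub.⊥
  nth-map-beyond f [] j _ = refl
  nth-map-beyond f (x ∷ xs) (suc j) (s≤s le) = nth-map-beyond f xs j le

  width-pos : ∀ {m} (v : Vec Bool m) (η : Vec ℕ (ones v)) → (∀ k → 1 ≤ Vec.lookup η k) → ∀ i → 0 < width v η i
  width-pos (true ∷ v) (e ∷ η) η≥1 zero = η≥1 zero
  width-pos (true ∷ v) (e ∷ η) η≥1 (suc i) = width-pos v η (λ k → η≥1 (suc k)) i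
  width-pos (false ∷ v) η η≥1 zero = s≤s z≤n
  width-pos (false ∷ v) η η≥1 (suc i) = width-pos v η η≥1 i

  module LongRepresentation {m : ℕ} (v : Vec Bool m) (η : Vec ℕ (ones v)) where

    Piece : Set
    Piece = Σ (Fin m) (λ i → Fin (width v η i))

    piece : ∀ {n} → Seq n v η → Piece → Subset n
    piece χ (i , a) = Vec.lookup (pieces χ i) a

    blockPieces : Fin m → List Piece
    blockPieces i = map (i ,_) (allFin (width v η i))

    pieceOrder : List Piece
    pieceOrder = concatMap blockPieces (allFin m)

    Before : Piece → Piece → Set
    Before (i , a) (i' , a') = i Fin.< i' ⊎ (toℕ i ≡ toℕ i' × toℕ a ℕ.< toℕ a')

    pieceOrder-sorted : AllPairs Before pieceOrder
    pieceOrder-sorted = AllPairsP.concat⁺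
      (AllP.map⁺ (AllP.tabulate⁺ (λ i → AllPairsP.map⁺ (AllPairsP.tabulate⁺-< (λ a<a' → inj₂ (refl , a<a'))))))
      (AllPairsP.map⁺ (AllPairsP.tabulate⁺-< (λ i<i' →
        AllP.map⁺ (AllP.tabulate⁺ (λ a → AllP.map⁺ (AllP.tabulate⁺ (λ a' → inj₁ i<i')))))))

    pieceOrder-complete : ∀ g → g ∈ₗ pieceOrder
    pieceOrder-complete (i , a) =
      ∈-concatMap⁺ blockPieces (Any.map (λ { refl → ∈-map⁺ (i ,_) (∈-allFin a) }) (∈-allFin i))

    K : ℕ
    K = length pieceOrder

    long-pieces : ∀ {n} (χ : Seq n v η) → long χ ≡ map (piece χ) pieceOrder
    long-pieces χ = blocks (allFin m)
      where
      toList-tabulate : ∀ {w} (ps : Vec (Subset _) w) → toList ps ≡ List.tabulate (Vec.lookup ps)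
      toList-tabulate [] = refl
      toList-tabulate (p ∷ ps) = cong (p ∷_) (toList-tabulate ps)
      block : ∀ i → toList (pieces χ i) ≡ map (piece χ) (blockPieces i)
      block i = trans (toList-tabulate (pieces χ i))
        (trans (sym (map-tabulate (λ a → a) (λ a → piece χ (i , a))))
               (map-∘ {g = piece χ} {f = i ,_} (allFin (width v η i))))
      blocks : ∀ is → concatMap (λ i → toList (pieces χ i)) is ≡ map (piece χ) (concatMap blockPieces is)
      blocks [] = refl
      blocks (i ∷ is) = trans (cong₂ _++_ (block i) (blocks is))
                          (sym (map-++ (piece χ) (blockPieces i) (concatMap blockPieces is)))

    -- The parts of the long representation, numbered from 0 (longAt χ j = part χ (j - 1)).
    part : ∀ {n} → Seq n v η → ℕ → Subset n
    part χ j = nth (long χ) j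

    part-lookup : ∀ {n} (χ : Seq n v η) (j : Fin K) → part χ (toℕ j) ≡ piece χ (List.lookup pieceOrder j)
    part-lookup χ j = trans (cong (λ xs → nth xs (toℕ j)) (long-pieces χ)) (nth-map-lookup (piece χ) pieceOrder j)

    part-beyond : ∀ {n} (χ : Seq n v η) j → K ≤ j → part χ j ≡ Sub.⊥
    part-beyond χ j K≤j = trans (cong (λ xs → nth xs j) (long-pieces χ)) (nth-map-beyond (piece χ) pieceOrder j K≤j)

    piece-part : ∀ {n} (χ : Seq n v η) g → Σ (Fin K) λ j → part χ (toℕ j) ≡ piece χ g
    piece-part χ g = Any.index (pieceOrder-complete g) ,
      trans (part-lookup χ _) (cong (piece χ) (sym (lookup-index (pieceOrder-complete g))))

    index-below : ∀ {j} → j < K → Σ (Fin K) λ j' → toℕ j' ≡ j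
    index-below j<K = fromℕ< j<K , toℕ-fromℕ< j<K

    part-index : ∀ {n} (χ : Seq n v η) {j x} → x ∈ part χ j → Σ (Fin K) λ j' → toℕ j' ≡ j
    part-index χ {j} x∈ with j <? K
    ... | yes j<K = index-below j<K
    ... | no j≮K = contradiction (subst (_ ∈_) (part-beyond χ j (≮⇒≥ j≮K)) x∈) ∉⊥

module IntegralMSequences where

  open import Data.Bool using (Bool; true; false; if_then_else_)
  open import Data.Empty using () renaming (⊥ to Empty)
  open import Data.Fin as Fin using (Fin; zero; suc; toℕ; fromℕ<)
  open import Data.Fin.Properties using (toℕ-injective)
  import Data.Fin.Properties as Fin
  open import Data.Fin.Subset as Sub using (Subset; _∈_; _⊆_; ∣_∣; ⋃; _∩_)
  open import Data.Fin.Subset.Properties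
    using (⊆-trans; p⊆p∪q; q⊆p∪q; x∈p∪q⁻; p∩q⊆p; ∪-identityʳ; ∩-zeroˡ; p⊆q⇒∣p∣≤∣q∣)
  open import Data.List as List using ([]; _∷_; map)
  open import Data.List.Properties using (map-∘; map-cong)
  import Data.List.Relation.Unary.All as All
  open import Data.Nat as ℕ using (ℕ; zero; suc; _*_; _≤_; _<_; z≤n; NonZero)
  open import Data.Nat.Properties
  open import Data.Nat.Tactic.RingSolver using (solve-∀)
  open import Data.Product using (_,_; proj₂)
  open import Data.Sum using (inj₁; inj₂)
  open import Data.Vec as Vec using (Vec; []; _∷_; toList)
  open import Data.Vec.Properties using (lookup-map; toList-map)
  open import Relation.Binary using (tri<; tri≈; tri>)
  open import Relation.Binary.PropositionalEquality
  open import Relation.Nullary using (yes; no; contradiction)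
  open import Defs
  open Counting
  open NonEdges
  open Pieces

  lookup-⊆-⋃ : ∀ {n w} (ps : Vec (Subset n) w) a → Vec.lookup ps a ⊆ ⋃ (toList ps)
  lookup-⊆-⋃ (p ∷ ps) zero = p⊆p∪q (⋃ (toList ps))
  lookup-⊆-⋃ (p ∷ ps) (suc a) = ⊆-trans (lookup-⊆-⋃ ps a) (q⊆p∪q p (⋃ (toList ps)))

  ⋃-map-∩⊆ : ∀ {n} (R : Subset n) xs → ⋃ (map (_∩ R) xs) ⊆ ⋃ xs
  ⋃-map-∩⊆ R [] x∈ = x∈
  ⋃-map-∩⊆ R (p ∷ xs) x∈ with x∈p∪q⁻ (p ∩ R) (⋃ (map (_∩ R) xs)) x∈
  ... | inj₁ x∈p = p⊆p∪q (⋃ xs) (p∩q⊆p p R x∈p)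
  ... | inj₂ x∈xs = q⊆p∪q p (⋃ xs) (⋃-map-∩⊆ R xs x∈xs)

  Transitive-⊆ : ∀ {n} (adj : Adj n) {S S' : Subset n} → S' ⊆ S → Transitive adj S → Transitive adj S'
  Transitive-⊆ adj S'⊆S trS [] ()
  Transitive-⊆ adj S'⊆S trS (x ∷ xs) (unique , inside , path) = trS (x ∷ xs) (unique , All.map S'⊆S inside , path)

  single-piece : ∀ {n} b w (ps : Vec (Subset n) (if b then w else 1)) → b ≡ false →
    ∀ a → ∣ ⋃ (toList ps) ∣ ≡ ∣ Vec.lookup ps a ∣
  single-piece false w (p ∷ []) refl zero = cong ∣_∣ (∪-identityʳ p)

  single-index : ∀ b w (a a' : Fin (if b then w else 1)) → b ≡ false → a ≡ a'
  single-index false w zero zero refl = refl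

  -- A (v, η, 1/N, 1/L)-m-sequence, with the rational bounds cleared of denominators:
  -- d(S_i , S_j) ≥ 1 - 1/L becomes L · NE(S_i , S_j) ≤ |S_i| |S_j|.
  record IsMSeqℕ {n m : ℕ} (adj : Adj n) (t : ℕ) (v : Vec Bool m) (η : Vec ℕ (ones v))
                 (N L : ℕ) (χ : Seq n v η) : Set where
    field
      disjoint      : ∀ i j → i ≢ j → Disjoint (blockSet χ i) (blockSet χ j)
      plainBig      : ∀ i → Vec.lookup v i ≡ false → n ≤ N * ∣ blockSet χ i ∣
      transTrans    : ∀ i → Vec.lookup v i ≡ true → Transitive adj (blockSet χ i)
      partsDisjoint : ∀ i → Vec.lookup v i ≡ true → ∀ a b → a ≢ b →
                        Disjoint (Vec.lookup (pieces χ i) a) (Vec.lookup (pieces χ i) b)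
      partsComplete : ∀ i → Vec.lookup v i ≡ true → ∀ a b → a Fin.< b →
                        Complete adj (Vec.lookup (pieces χ i) a) (Vec.lookup (pieces χ i) b)
      partsBig      : ∀ i → Vec.lookup v i ≡ true → ∀ a → t ≤ N * ∣ Vec.lookup (pieces χ i) a ∣
      dense         : ∀ i j → i Fin.< j →
                        L * NE adj (blockSet χ i) (blockSet χ j) ≤ ∣ blockSet χ i ∣ * ∣ blockSet χ j ∣

  module MSequence {m : ℕ} (v : Vec Bool m) (η : Vec ℕ (ones v)) where
    open LongRepresentation v η

    module Parts {n : ℕ} {adj : Adj n} {t N L : ℕ} (χ : Seq n v η) (ms : IsMSeqℕ adj t v η N L χ)
                 (tr : IsTr adj t) .{{_ : NonZero N}} where
      open IsMSeqℕ ms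

      piece⊆block : ∀ i a → piece χ (i , a) ⊆ blockSet χ i
      piece⊆block i a = lookup-⊆-⋃ (pieces χ i) a

      block≤piece : ∀ i a → ∣ blockSet χ i ∣ ≤ N * ∣ piece χ (i , a) ∣
      block≤piece i a = byKind (Vec.lookup v i) refl
        where
        byKind : ∀ b → Vec.lookup v i ≡ b → ∣ blockSet χ i ∣ ≤ N * ∣ piece χ (i , a) ∣
        byKind true vi = ≤-trans (proj₂ tr (blockSet χ i) (transTrans i vi)) (partsBig i vi a)
        byKind false vi = ≤-trans (≤-reflexive (single-piece (Vec.lookup v i) (etaAt v η i) (pieces χ i) vi a))
                                  (m≤n*m ∣ piece χ (i , a) ∣ N)

      pieces-disjoint : ∀ g g' → Before g g' → Disjoint (piece χ g) (piece χ g')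
      pieces-disjoint (i , a) (i' , a') (inj₁ i<i') x x∈ x∈' =
        disjoint i i' (Fin.<⇒≢ i<i') x (piece⊆block i a x∈) (piece⊆block i' a' x∈')
      pieces-disjoint (i , a) (i' , a') (inj₂ (i≡i' , a<a')) x x∈ x∈' with toℕ-injective i≡i'
      ... | refl = byKind (Vec.lookup v i) refl
        where
        byKind : ∀ b → Vec.lookup v i ≡ b → Empty
        byKind true vi = partsDisjoint i vi a a' (λ { refl → <-irrefl refl a<a' }) x x∈ x∈'
        byKind false vi = <-irrefl (cong toℕ (single-index (Vec.lookup v i) (etaAt v η i) a a' vi)) a<a'

      pieces-sparse : ∀ g g' → Before g g' →
        L * NE adj (piece χ g) (piece χ g') ≤ N * N * (∣ piece χ g ∣ * ∣ piece χ g' ∣)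
      pieces-sparse (i , a) (i' , a') (inj₁ i<i') = begin
        L * NE adj (piece χ (i , a)) (piece χ (i' , a'))
          ≤⟨ *-monoʳ-≤ L (NE-mono adj (piece⊆block i a) (piece⊆block i' a')) ⟩
        L * NE adj (blockSet χ i) (blockSet χ i')  ≤⟨ dense i i' i<i' ⟩
        ∣ blockSet χ i ∣ * ∣ blockSet χ i' ∣       ≤⟨ *-mono-≤ (block≤piece i a) (block≤piece i' a') ⟩
        N * ∣ piece χ (i , a) ∣ * (N * ∣ piece χ (i' , a') ∣)
          ≡⟨ regroup N ∣ piece χ (i , a) ∣ ∣ piece χ (i' , a') ∣ ⟩
        N * N * (∣ piece χ (i , a) ∣ * ∣ piece χ (i' , a') ∣) ∎
        where
        open ≤-Reasoning
        regroup : ∀ n a b → n * a * (n * b) ≡ n * n * (a * b)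
        regroup = solve-∀
      pieces-sparse (i , a) (i' , a') (inj₂ (i≡i' , a<a')) with toℕ-injective i≡i'
      ... | refl = byKind (Vec.lookup v i) refl
        where
        byKind : ∀ b → Vec.lookup v i ≡ b →
          L * NE adj (piece χ (i , a)) (piece χ (i , a')) ≤ N * N * (∣ piece χ (i , a) ∣ * ∣ piece χ (i , a') ∣)
        byKind true vi rewrite NE-complete adj _ _ (partsComplete i vi a a' a<a') | *-zeroʳ L = z≤n
        byKind false vi = contradiction (cong toℕ (single-index (Vec.lookup v i) (etaAt v η i) a a' vi)) (<⇒≢ a<a')

      parts-disjoint : ∀ j l → j ≢ l → Disjoint (part χ j) (part χ l)
      parts-disjoint j l j≢l x x∈j x∈l with part-index χ x∈j | part-index χ x∈l
      ... | j' , refl | l' , refl with Fin.<-cmp j' l'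
      ... | tri< j'<l' _ _ = pieces-disjoint _ _ (AllPairs-lookup pieceOrder-sorted j'<l') x
                               (subst (x ∈_) (part-lookup χ j') x∈j) (subst (x ∈_) (part-lookup χ l') x∈l)
      ... | tri≈ _ refl _ = j≢l refl
      ... | tri> _ _ l'<j' = pieces-disjoint _ _ (AllPairs-lookup pieceOrder-sorted l'<j') x
                               (subst (x ∈_) (part-lookup χ l') x∈l) (subst (x ∈_) (part-lookup χ j') x∈j)

      parts-sparse : ∀ j l → j < l → L * NE adj (part χ j) (part χ l) ≤ N * N * (∣ part χ j ∣ * ∣ part χ l ∣)
      parts-sparse j l j<l with l <? K
      ... | no l≮K rewrite part-beyond χ l (≮⇒≥ l≮K) | NE-⊥ adj (part χ j) | *-zeroʳ L = z≤n
      ... | yes l<K with index-below (<-trans j<l l<K) | index-below l<K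
      ...   | j' , refl | l' , refl rewrite part-lookup χ j' | part-lookup χ l' =
        pieces-sparse _ _ (AllPairs-lookup pieceOrder-sorted j<l)

    restrict : ∀ {n} → Subset n → Seq n v η → Seq n v η
    restrict R χ = mkSeq (λ i → Vec.map (_∩ R) (pieces χ i))

    module Restriction {n : ℕ} (R : Subset n) (χ : Seq n v η) where

      piece-restrict : ∀ g → piece (restrict R χ) g ≡ piece χ g ∩ R
      piece-restrict (i , a) = lookup-map a (_∩ R) (pieces χ i)

      piece⊆piece : ∀ g → piece (restrict R χ) g ⊆ piece χ g
      piece⊆piece g x∈ = p∩q⊆p (piece χ g) R (subst (_ ∈_) (piece-restrict g) x∈)

      part-restrict : ∀ j → part (restrict R χ) j ≡ part χ j ∩ R
      part-restrict j with j <? K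
      ... | yes j<K with index-below j<K
      ...   | j' , refl = trans (part-lookup (restrict R χ) j')
                            (trans (piece-restrict _) (cong (_∩ R) (sym (part-lookup χ j'))))
      part-restrict j | no j≮K rewrite part-beyond (restrict R χ) j (≮⇒≥ j≮K) | part-beyond χ j (≮⇒≥ j≮K) =
        sym (∩-zeroˡ R)

      block⊆block : ∀ i → blockSet (restrict R χ) i ⊆ blockSet χ i
      block⊆block i x∈ = ⋃-map-∩⊆ R (toList (pieces χ i)) (subst (λ ps → _ ∈ ⋃ ps) (toList-map (_∩ R) (pieces χ i)) x∈)

      Vχ⊆Vχ : Vχ (restrict R χ) ⊆ Vχ χ
      Vχ⊆Vχ x∈ = ⋃-map-∩⊆ R (long χ) (subst (λ ps → _ ∈ ⋃ ps) long-restrict x∈)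
        where
        long-restrict : long (restrict R χ) ≡ map (_∩ R) (long χ)
        long-restrict = begin
          long (restrict R χ)                      ≡⟨ long-pieces (restrict R χ) ⟩
          map (piece (restrict R χ)) pieceOrder    ≡⟨ map-cong piece-restrict pieceOrder ⟩
          map (λ g → piece χ g ∩ R) pieceOrder     ≡⟨ map-∘ pieceOrder ⟩
          map (_∩ R) (map (piece χ) pieceOrder)    ≡⟨ cong (map (_∩ R)) (sym (long-pieces χ)) ⟩
          map (_∩ R) (long χ)                      ∎
          where open ≡-Reasoning

    module HalfRestriction {n : ℕ} {adj : Adj n} {t N L : ℕ} (χ : Seq n v η)
        (ms : IsMSeqℕ adj t v η N L χ) (tr : IsTr adj t) .{{_ : NonZero N}}
        (nonempty : ∀ i → 0 < width v η i) (R : Subset n)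
        (halves : ∀ (j : Fin K) → ∣ part χ (toℕ j) ∣ ≤ 2 * ∣ part χ (toℕ j) ∩ R ∣) where
      open IsMSeqℕ ms
      open Parts χ ms tr using (block≤piece)
      open Restriction R χ

      χ′ : Seq n v η
      χ′ = restrict R χ

      piece-halves : ∀ g → ∣ piece χ g ∣ ≤ 2 * ∣ piece χ′ g ∣
      piece-halves g with piece-part χ g
      ... | j , part≡piece rewrite piece-restrict g = subst (λ p → ∣ p ∣ ≤ 2 * ∣ p ∩ R ∣) part≡piece (halves j)

      twice-inside : ∀ a b → a * (2 * b) ≡ 2 * a * b
      twice-inside = solve-∀

      firstPiece : ∀ i → Fin (width v η i)
      firstPiece i = fromℕ< (nonempty i)

      piece′≤block′ : ∀ i → ∣ piece χ′ (i , firstPiece i) ∣ ≤ ∣ blockSet χ′ i ∣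
      piece′≤block′ i = p⊆q⇒∣p∣≤∣q∣ (lookup-⊆-⋃ (pieces χ′ i) (firstPiece i))

      -- Via the first piece, |S_i| ≤ N |S_{i,1}| ≤ 2N |S′_i|.
      firstPiece≤block′ : ∀ i → N * ∣ piece χ (i , firstPiece i) ∣ ≤ 2 * N * ∣ blockSet χ′ i ∣
      firstPiece≤block′ i = begin
        N * ∣ piece χ (i , firstPiece i) ∣        ≤⟨ *-monoʳ-≤ N (piece-halves (i , firstPiece i)) ⟩
        N * (2 * ∣ piece χ′ (i , firstPiece i) ∣) ≤⟨ *-monoʳ-≤ N (*-monoʳ-≤ 2 (piece′≤block′ i)) ⟩
        N * (2 * ∣ blockSet χ′ i ∣)               ≡⟨ twice-inside N ∣ blockSet χ′ i ∣ ⟩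
        2 * N * ∣ blockSet χ′ i ∣                 ∎
        where open ≤-Reasoning

      block≤block′ : ∀ i → ∣ blockSet χ i ∣ ≤ 2 * N * ∣ blockSet χ′ i ∣
      block≤block′ i = ≤-trans (block≤piece i (firstPiece i)) (firstPiece≤block′ i)

      plainBig′ : ∀ i → Vec.lookup v i ≡ false → n ≤ 2 * N * ∣ blockSet χ′ i ∣
      plainBig′ i vi = ≤-trans (plainBig i vi) (≤-trans
        (≤-reflexive (cong (N *_) (single-piece (Vec.lookup v i) (etaAt v η i) (pieces χ i) vi (firstPiece i))))
        (firstPiece≤block′ i))

      partsBig′ : ∀ i → Vec.lookup v i ≡ true → ∀ a → t ≤ 2 * N * ∣ piece χ′ (i , a) ∣
      partsBig′ i vi a = begin
        t                              ≤⟨ partsBig i vi a ⟩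
        N * ∣ piece χ (i , a) ∣        ≤⟨ *-monoʳ-≤ N (piece-halves (i , a)) ⟩
        N * (2 * ∣ piece χ′ (i , a) ∣) ≡⟨ twice-inside N ∣ piece χ′ (i , a) ∣ ⟩
        2 * N * ∣ piece χ′ (i , a) ∣   ∎
        where open ≤-Reasoning

      dense′ : ∀ L′ → 4 * (N * N) * L′ ≤ L → ∀ i j → i Fin.< j →
        L′ * NE adj (blockSet χ′ i) (blockSet χ′ j) ≤ ∣ blockSet χ′ i ∣ * ∣ blockSet χ′ j ∣
      dense′ L′ enough i j i<j = *-cancelˡ-≤ (4 * (N * N)) {{m*n≢0 4 (N * N) {{_}} {{m*n≢0 N N}}}} (begin
        4 * (N * N) * (L′ * NE′)                        ≡⟨ sym (*-assoc (4 * (N * N)) L′ NE′) ⟩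
        4 * (N * N) * L′ * NE′                          ≤⟨ *-monoˡ-≤ NE′ enough ⟩
        L * NE′                                          ≤⟨ *-monoʳ-≤ L (NE-mono adj (block⊆block i) (block⊆block j)) ⟩
        L * NE adj (blockSet χ i) (blockSet χ j)        ≤⟨ dense i j i<j ⟩
        ∣ blockSet χ i ∣ * ∣ blockSet χ j ∣             ≤⟨ *-mono-≤ (block≤block′ i) (block≤block′ j) ⟩
        2 * N * ∣ blockSet χ′ i ∣ * (2 * N * ∣ blockSet χ′ j ∣)
          ≡⟨ regroup N ∣ blockSet χ′ i ∣ ∣ blockSet χ′ j ∣ ⟩
        4 * (N * N) * (∣ blockSet χ′ i ∣ * ∣ blockSet χ′ j ∣) ∎)
        where
        open ≤-Reasoning
        NE′ : ℕ
        NE′ = NE adj (blockSet χ′ i) (blockSet χ′ j)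
        regroup : ∀ n a b → 2 * n * a * (2 * n * b) ≡ 4 * (n * n) * (a * b)
        regroup = solve-∀

      restricted : ∀ L′ → 4 * (N * N) * L′ ≤ L → IsMSeqℕ adj t v η (2 * N) L′ χ′
      restricted L′ enough = record
        { disjoint = λ i j i≢j x x∈i x∈j → disjoint i j i≢j x (block⊆block i x∈i) (block⊆block j x∈j)
        ; plainBig = plainBig′
        ; transTrans = λ i vi → Transitive-⊆ adj (block⊆block i) (transTrans i vi)
        ; partsDisjoint = λ i vi a b a≢b x x∈a x∈b →
            partsDisjoint i vi a b a≢b x (piece⊆piece (i , a) x∈a) (piece⊆piece (i , b) x∈b)
        ; partsComplete = λ i vi a b a<b x y x∈a y∈b →
            partsComplete i vi a b a<b x y (piece⊆piece (i , a) x∈a) (piece⊆piece (i , b) y∈b)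
        ; partsBig = partsBig′
        ; dense = dense′ L′ enough
        }

module UnitFractions where

  open import Data.Integer as ℤ using (+_; +[1+_])
  import Data.Integer.Properties as ℤ
  open import Data.Nat as ℕ using (ℕ; suc; _+_; _*_; _≤_; z≤n; s≤s)
  open import Data.Nat.Coprimality as Coprime using (Coprime; 1-coprimeTo)
  import Data.Nat.Properties as ℕ
  open import Data.Product using (Σ; _,_)
  open import Data.Rational as ℚ using (ℚ; mkℚ; _/_; 1ℚ; Positive; NonNegative)
  import Data.Rational.Properties as ℚ
  open import Data.Rational.Solver using (module +-*-Solver)
  open import Data.Rational.Unnormalised as ℚᵘ using (mkℚᵘ; *≤*; *≡*)
  import Data.Rational.Unnormalised.Properties as ℚᵘ
  open import Function.Bundles using (_⇔_; mk⇔; Equivalence)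
  open import Relation.Binary.PropositionalEquality
  open import Defs using (ℕ→ℚ)

  unit : ℕ → ℚ
  unit d = (+ 1) / suc d

  ℕ→ℚ-canonical : ∀ a → ℕ→ℚ a ≡ mkℚ (+ a) 0 (Coprime.sym (1-coprimeTo a))
  ℕ→ℚ-canonical a = ℚ.normalize-coprime (Coprime.sym (1-coprimeTo a))

  unit-canonical : ∀ d → unit d ≡ mkℚ (+ 1) d (1-coprimeTo (suc d))
  unit-canonical d = ℚ.normalize-coprime (1-coprimeTo (suc d))

  toℚᵘ-unit*ℕ : ∀ d a → ℚ.toℚᵘ (unit d ℚ.* ℕ→ℚ a) ℚᵘ.≃ mkℚᵘ (+ a) d
  toℚᵘ-unit*ℕ d a rewrite unit-canonical d | ℕ→ℚ-canonical a =
    ℚᵘ.≃-trans (ℚ.toℚᵘ-homo-* (mkℚ (+ 1) d (1-coprimeTo (suc d))) (mkℚ (+ a) 0 (Coprime.sym (1-coprimeTo a))))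
      (*≡* (trans (cong (ℤ._* (+ suc d)) (ℤ.*-identityˡ (+ a))) (cong (λ k → + a ℤ.* + suc k) (sym (ℕ.*-identityʳ d)))))

  toℚᵘ-ℕ : ∀ a → ℚ.toℚᵘ (ℕ→ℚ a) ≡ mkℚᵘ (+ a) 0
  toℚᵘ-ℕ a = cong ℚ.toℚᵘ (ℕ→ℚ-canonical a)

  ℚᵘ-≤⇔ : ∀ a d b e → (mkℚᵘ (+ a) d ℚᵘ.≤ mkℚᵘ (+ b) e) ⇔ (a * suc e ≤ b * suc d)
  ℚᵘ-≤⇔ a d b e = mk⇔
    (λ { (*≤* le) → ℤ.drop‿+≤+ (subst₂ ℤ._≤_ (sym (ℤ.pos-* a (suc e))) (sym (ℤ.pos-* b (suc d))) le) })
    (λ le → *≤* (subst₂ ℤ._≤_ (ℤ.pos-* a (suc e)) (ℤ.pos-* b (suc d)) (ℤ.+≤+ le)))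

  unit*ℕ≤ℕ⇔ : ∀ d a b → (unit d ℚ.* ℕ→ℚ a ℚ.≤ ℕ→ℚ b) ⇔ (a ≤ suc d * b)
  unit*ℕ≤ℕ⇔ d a b = mk⇔
    (λ le → rearrange⁻ (Equivalence.to (ℚᵘ-≤⇔ a d b 0)
       (ℚᵘ.≤-respˡ-≃ (toℚᵘ-unit*ℕ d a) (subst (ℚᵘ._≤_ _) (toℚᵘ-ℕ b) (ℚ.toℚᵘ-mono-≤ le)))))
    (λ le → ℚ.toℚᵘ-cancel-≤ (subst (ℚᵘ._≤_ _) (sym (toℚᵘ-ℕ b))
       (ℚᵘ.≤-respˡ-≃ (ℚᵘ.≃-sym (toℚᵘ-unit*ℕ d a)) (Equivalence.from (ℚᵘ-≤⇔ a d b 0) (rearrange le)))))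
    where
    rearrange : a ≤ suc d * b → a * 1 ≤ b * suc d
    rearrange le = subst₂ _≤_ (sym (ℕ.*-identityʳ a)) (ℕ.*-comm (suc d) b) le
    rearrange⁻ : a * 1 ≤ b * suc d → a ≤ suc d * b
    rearrange⁻ le = subst₂ _≤_ (ℕ.*-identityʳ a) (ℕ.*-comm b (suc d)) le

  ℕ≤unit*ℕ⇔ : ∀ d a b → (ℕ→ℚ a ℚ.≤ unit d ℚ.* ℕ→ℚ b) ⇔ (suc d * a ≤ b)
  ℕ≤unit*ℕ⇔ d a b = mk⇔
    (λ le → rearrange⁻ (Equivalence.to (ℚᵘ-≤⇔ a 0 b d)
       (ℚᵘ.≤-respʳ-≃ (toℚᵘ-unit*ℕ d b) (subst (λ q → q ℚᵘ.≤ _) (toℚᵘ-ℕ a) (ℚ.toℚᵘ-mono-≤ le)))))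
    (λ le → ℚ.toℚᵘ-cancel-≤ (subst (λ q → q ℚᵘ.≤ _) (sym (toℚᵘ-ℕ a))
       (ℚᵘ.≤-respʳ-≃ (ℚᵘ.≃-sym (toℚᵘ-unit*ℕ d b)) (Equivalence.from (ℚᵘ-≤⇔ a 0 b d) (rearrange le)))))
    where
    rearrange : suc d * a ≤ b → a * suc d ≤ b * 1
    rearrange le = subst₂ _≤_ (ℕ.*-comm (suc d) a) (sym (ℕ.*-identityʳ b)) le
    rearrange⁻ : a * suc d ≤ b * 1 → suc d * a ≤ b
    rearrange⁻ le = subst₂ _≤_ (ℕ.*-comm a (suc d)) (ℕ.*-identityʳ b) le

  ℕ→ℚ-nonNegative : ∀ a → NonNegative (ℕ→ℚ a)
  ℕ→ℚ-nonNegative a = subst NonNegative (sym (ℕ→ℚ-canonical a)) _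

  ℕ→ℚ-+ : ∀ a b → ℕ→ℚ (a + b) ≡ ℕ→ℚ a ℚ.+ ℕ→ℚ b
  ℕ→ℚ-+ a b = ℚ.toℚᵘ-injective (begin
    ℚ.toℚᵘ (ℕ→ℚ (a + b))                      ≡⟨ toℚᵘ-ℕ (a + b) ⟩
    mkℚᵘ (+ (a + b)) 0                         ≈⟨ *≡* (cong (ℤ._* + 1) sum) ⟩
    mkℚᵘ (+ a) 0 ℚᵘ.+ mkℚᵘ (+ b) 0             ≡⟨ sym (cong₂ ℚᵘ._+_ (toℚᵘ-ℕ a) (toℚᵘ-ℕ b)) ⟩
    ℚ.toℚᵘ (ℕ→ℚ a) ℚᵘ.+ ℚ.toℚᵘ (ℕ→ℚ b)        ≈⟨ ℚᵘ.≃-sym (ℚ.toℚᵘ-homo-+ (ℕ→ℚ a) (ℕ→ℚ b)) ⟩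
    ℚ.toℚᵘ (ℕ→ℚ a ℚ.+ ℕ→ℚ b)                  ∎)
    where
    open ℚᵘ.≃-Reasoning
    sum : + (a + b) ≡ + a ℤ.* + 1 ℤ.+ + b ℤ.* + 1
    sum = trans (ℤ.pos-+ a b) (sym (cong₂ ℤ._+_ (ℤ.*-identityʳ (+ a)) (ℤ.*-identityʳ (+ b))))

  unit-positive : ∀ d → Positive (unit d)
  unit-positive d = ℚ.normalize-pos 1 (suc d)

  unit-nonNegative : ∀ d → NonNegative (unit d)
  unit-nonNegative d = ℚ.pos⇒nonNeg (unit d) {{unit-positive d}}

  unit<1 : ∀ d → unit (suc d) ℚ.< 1ℚ
  unit<1 d rewrite unit-canonical (suc d) = ℚ.*<* (ℤ.+<+ (s≤s (s≤s z≤n)))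

  unit-antitone : ∀ {d d'} → d ≤ d' → unit d' ℚ.≤ unit d
  unit-antitone {d} {d'} d≤d' rewrite unit-canonical d | unit-canonical d' =
    ℚ.*≤* (subst₂ ℤ._≤_ (sym (ℤ.*-identityˡ (+ suc d))) (sym (ℤ.*-identityˡ (+ suc d'))) (ℤ.+≤+ (s≤s d≤d')))

  positive⇒unit≤ : ∀ q → Positive q → Σ ℕ λ d → unit d ℚ.≤ q
  positive⇒unit≤ (mkℚ +[1+ p ] d c) _ = d , subst (ℚ._≤ mkℚ +[1+ p ] d c) (sym (unit-canonical d))
    (ℚ.*≤* (ℤ.*-monoʳ-≤-nonNeg (+ suc d) {+ 1} {+[1+ p ]} (ℤ.+≤+ (s≤s z≤n))))

  scaled-mono : ∀ {c c'} a b → c ℚ.≤ c' → c' ℚ.* ℕ→ℚ a ℚ.≤ ℕ→ℚ b → c ℚ.* ℕ→ℚ a ℚ.≤ ℕ→ℚ b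
  scaled-mono a b c≤c' le = ℚ.≤-trans (ℚ.*-monoʳ-≤-nonNeg (ℕ→ℚ a) {{ℕ→ℚ-nonNegative a}} c≤c') le

  complement-≤⇔ : ∀ l e f → ((1ℚ ℚ.- l) ℚ.* (e ℚ.+ f) ℚ.≤ e) ⇔ (f ℚ.≤ l ℚ.* (e ℚ.+ f))
  complement-≤⇔ l e f = mk⇔
    (λ le → begin
      f                                       ≡⟨ split₁ l e f ⟩
      ((1ℚ ℚ.- l) ℚ.* (e ℚ.+ f) ℚ.+ l ℚ.* (e ℚ.+ f)) ℚ.- e
                                              ≤⟨ ℚ.+-monoˡ-≤ (ℚ.- e) (ℚ.+-monoˡ-≤ (l ℚ.* (e ℚ.+ f)) le) ⟩
      (e ℚ.+ l ℚ.* (e ℚ.+ f)) ℚ.- e           ≡⟨ cancel₁ l e f ⟩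
      l ℚ.* (e ℚ.+ f)                         ∎)
    (λ le → begin
      (1ℚ ℚ.- l) ℚ.* (e ℚ.+ f)                ≡⟨ split₂ l e f ⟩
      (e ℚ.+ f) ℚ.- l ℚ.* (e ℚ.+ f)           ≤⟨ ℚ.+-monoˡ-≤ (ℚ.- (l ℚ.* (e ℚ.+ f))) (ℚ.+-monoʳ-≤ e le) ⟩
      (e ℚ.+ l ℚ.* (e ℚ.+ f)) ℚ.- l ℚ.* (e ℚ.+ f) ≡⟨ cancel₂ l e f ⟩
      e                                       ∎)
    where
    open ℚ.≤-Reasoning
    open +-*-Solver
    split₁ : ∀ l e f → f ≡ ((1ℚ ℚ.- l) ℚ.* (e ℚ.+ f) ℚ.+ l ℚ.* (e ℚ.+ f)) ℚ.- e
    split₁ = solve 3 (λ l e f → f := ((con 1ℚ :- l) :* (e :+ f) :+ l :* (e :+ f)) :- e) refl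
    cancel₁ : ∀ l e f → (e ℚ.+ l ℚ.* (e ℚ.+ f)) ℚ.- e ≡ l ℚ.* (e ℚ.+ f)
    cancel₁ = solve 3 (λ l e f → (e :+ l :* (e :+ f)) :- e := l :* (e :+ f)) refl
    split₂ : ∀ l e f → (1ℚ ℚ.- l) ℚ.* (e ℚ.+ f) ≡ (e ℚ.+ f) ℚ.- l ℚ.* (e ℚ.+ f)
    split₂ = solve 3 (λ l e f → (con 1ℚ :- l) :* (e :+ f) := (e :+ f) :- l :* (e :+ f)) refl
    cancel₂ : ∀ l e f → (e ℚ.+ l ℚ.* (e ℚ.+ f)) ℚ.- l ℚ.* (e ℚ.+ f) ≡ e
    cancel₂ = solve 3 (λ l e f → (e :+ l :* (e :+ f)) :- l :* (e :+ f) := e) refl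

module RationalMSequences where

  open import Data.Bool using (Bool)
  open import Data.Fin as Fin using ()
  open import Data.Fin.Subset using (∣_∣)
  open import Data.Nat using (ℕ; suc; _*_; _≤_)
  open import Data.Rational as ℚ using (ℚ; 1ℚ; NonNegative)
  import Data.Rational.Properties as ℚ
  open import Data.Vec using (Vec)
  open import Function.Bundles using (_⇔_; Equivalence)
  open import Relation.Binary.PropositionalEquality
  open import Defs
  open NonEdges
  open IntegralMSequences
  open UnitFractions

  density⇔ : ∀ {n} (adj : Adj n) X Y λ' →
    DensityAtLeast adj X Y (1ℚ ℚ.- λ') ⇔ (ℕ→ℚ (NE adj X Y) ℚ.≤ λ' ℚ.* ℕ→ℚ (∣ X ∣ * ∣ Y ∣))
  density⇔ adj X Y λ' rewrite edges≡E adj X Y | sym (E+NE adj X Y) | ℕ→ℚ-+ (E adj X Y) (NE adj X Y) =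
    complement-≤⇔ λ' (ℕ→ℚ (E adj X Y)) (ℕ→ℚ (NE adj X Y))

  module _ {n m : ℕ} {adj : Adj n} {t : ℕ} {v : Vec Bool m} {η : Vec ℕ (ones v)} where

    fromℚ : ∀ {c λ' d L} (χ : Seq n v η) → IsMSeq adj t v η c λ' χ →
      unit d ℚ.≤ c → NonNegative λ' → λ' ℚ.≤ unit L → IsMSeqℕ adj t v η (suc d) (suc L) χ
    fromℚ {c} {λ'} {d} {L} χ ms d≤c λ'≥0 λ'≤L = record
      { disjoint = disjoint
      ; plainBig = λ i vi → big (plainBig i vi)
      ; transTrans = transTrans
      ; partsDisjoint = partsDisjoint
      ; partsComplete = partsComplete
      ; partsBig = λ i vi a → big (partsBig i vi a)
      ; dense = dense′
      }
      where
      open IsMSeq ms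
      big : ∀ {a b} → c ℚ.* ℕ→ℚ a ℚ.≤ ℕ→ℚ b → a ≤ suc d * b
      big {a} {b} le = Equivalence.to (unit*ℕ≤ℕ⇔ d a b) (scaled-mono a b d≤c le)
      dense′ : ∀ i j → i Fin.< j →
        suc L * NE adj (blockSet χ i) (blockSet χ j) ≤ ∣ blockSet χ i ∣ * ∣ blockSet χ j ∣
      dense′ i j i<j = Equivalence.to (ℕ≤unit*ℕ⇔ L _ _) (ℚ.≤-trans
        (Equivalence.to (density⇔ adj (blockSet χ i) (blockSet χ j) λ') (dense i j i<j))
        (ℚ.*-monoʳ-≤-nonNeg (ℕ→ℚ P) {{ℕ→ℚ-nonNegative P}} λ'≤L))
        where
        P = ∣ blockSet χ i ∣ * ∣ blockSet χ j ∣

    toℚ : ∀ {d L} (χ : Seq n v η) → IsMSeqℕ adj t v η (suc d) (suc L) χ → IsMSeq adj t v η (unit d) (unit L) χ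
    toℚ {d} {L} χ ms = record
      { disjoint = disjoint
      ; plainBig = λ i vi → Equivalence.from (unit*ℕ≤ℕ⇔ d _ _) (plainBig i vi)
      ; transTrans = transTrans
      ; partsDisjoint = partsDisjoint
      ; partsComplete = partsComplete
      ; partsBig = λ i vi a → Equivalence.from (unit*ℕ≤ℕ⇔ d _ _) (partsBig i vi a)
      ; dense = λ i j i<j → Equivalence.from (density⇔ adj (blockSet χ i) (blockSet χ j) (unit L))
                              (Equivalence.from (ℕ≤unit*ℕ⇔ L _ _) (dense i j i<j))
      }
      where open IsMSeqℕ ms

module Products where

  open import Data.Bool using (Bool; true; false; not; if_then_else_)
  open import Data.Bool.Properties using (∧-identityʳ)
  open import Data.Fin as Fin using (Fin; splitAt; _↑ˡ_; _↑ʳ_)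
  open import Data.Fin.Properties using (splitAt-↑ˡ; splitAt-↑ʳ; splitAt⁻¹-↑ˡ; splitAt⁻¹-↑ʳ)
  open import Data.Fin.Subset using (_∈_)
  open import Data.Nat as ℕ using (ℕ; _<ᵇ_)
  open import Data.Nat.Properties using (<-cmp; n≮n)
  open import Data.Product using (_,_)
  open import Data.Sum using (inj₁; inj₂) renaming ([_,_] to either)
  import Data.Vec
  open import Function.Definitions using (Injective)
  open import Relation.Binary using (tri<; tri≈; tri>)
  open import Relation.Binary.PropositionalEquality hiding ([_])
  open import Relation.Nullary using (yes; no; contradiction)
  open import Defs
  open Counting using (<ᵇ-true; <ᵇ-false)

  adj-from-backward : ∀ (H : Labelled) → IsTournament (adj H) → Injective _≡_ _≡_ (lab H) → ∀ a b →
    (if lab H a <ᵇ lab H b then not (backward H b a) else backward H a b) ≡ adj H a b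
  adj-from-backward H tour inj a b with a Fin.≟ b
  ... | yes refl rewrite <ᵇ-false (n≮n (lab H a)) | IsTournament.irrefl tour a = refl
  ... | no a≢b with <-cmp (lab H a) (lab H b)
  ... | tri< fa<fb _ _ rewrite <ᵇ-true fa<fb | ∧-identityʳ (adj H b a) = sym (IsTournament.total tour a b a≢b)
  ... | tri≈ _ fa≡fb _ = contradiction (inj fa≡fb) a≢b
  ... | tri> fa≮fb _ fb<fa rewrite <ᵇ-false fa≮fb | <ᵇ-true fb<fa | ∧-identityʳ (adj H a b) = refl

  <ᵇ-flip : ∀ {m n} → m ≢ n → (m <ᵇ n) ≡ not (n <ᵇ m)
  <ᵇ-flip {m} {n} m≢n with <-cmp m n
  ... | tri< m<n _ n≮m rewrite <ᵇ-true m<n | <ᵇ-false n≮m = refl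
  ... | tri≈ _ m≡n _ = contradiction m≡n m≢n
  ... | tri> m≮n _ n<m rewrite <ᵇ-false m≮n | <ᵇ-true n<m = refl

  module Product (H₁ H₂ : Labelled) where

    s₁ s₂ : ℕ
    s₁ = size H₁
    s₂ = size H₂

    data Side : Fin (s₁ ℕ.+ s₂) → Set where
      left  : ∀ a → Side (a ↑ˡ s₂)
      right : ∀ b → Side (s₁ ↑ʳ b)

    side : ∀ u → Side u
    side u with splitAt s₁ u in e
    ... | inj₁ a = subst Side (splitAt⁻¹-↑ˡ e) (left a)
    ... | inj₂ b = subst Side (splitAt⁻¹-↑ʳ e) (right b)

    lab-left : ∀ a → prodLab H₁ H₂ (a ↑ˡ s₂) ≡ lab H₁ a
    lab-left a rewrite splitAt-↑ˡ s₁ a s₂ = refl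

    lab-right : ∀ b → prodLab H₁ H₂ (s₁ ↑ʳ b) ≡ lab H₂ b
    lab-right b rewrite splitAt-↑ʳ s₁ s₂ b = refl

    module Edges (tour₁ : IsTournament (adj H₁)) (inj₁ : Injective _≡_ _≡_ (lab H₁))
                 (tour₂ : IsTournament (adj H₂)) (inj₂ : Injective _≡_ _≡_ (lab H₂))
                 (orth : ∀ a b → lab H₁ a ≢ lab H₂ b) where

      adj-left : ∀ a b → prodAdj H₁ H₂ (a ↑ˡ s₂) (b ↑ˡ s₂) ≡ adj H₁ a b
      adj-left a b rewrite splitAt-↑ˡ s₁ a s₂ | splitAt-↑ˡ s₁ b s₂ = adj-from-backward H₁ tour₁ inj₁ a b

      adj-right : ∀ a b → prodAdj H₁ H₂ (s₁ ↑ʳ a) (s₁ ↑ʳ b) ≡ adj H₂ a b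
      adj-right a b rewrite splitAt-↑ʳ s₁ s₂ a | splitAt-↑ʳ s₁ s₂ b = adj-from-backward H₂ tour₂ inj₂ a b

      adj-left-right : ∀ a b → prodAdj H₁ H₂ (a ↑ˡ s₂) (s₁ ↑ʳ b) ≡ (lab H₁ a <ᵇ lab H₂ b)
      adj-left-right a b rewrite splitAt-↑ˡ s₁ a s₂ | splitAt-↑ʳ s₁ s₂ b with lab H₁ a <ᵇ lab H₂ b
      ... | true = refl
      ... | false = refl

      adj-right-left : ∀ a b → prodAdj H₁ H₂ (s₁ ↑ʳ b) (a ↑ˡ s₂) ≡ (lab H₂ b <ᵇ lab H₁ a)
      adj-right-left a b rewrite splitAt-↑ˡ s₁ a s₂ | splitAt-↑ʳ s₁ s₂ b with lab H₂ b <ᵇ lab H₁ a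
      ... | true = refl
      ... | false = refl

      product-tournament : IsTournament (prodAdj H₁ H₂)
      product-tournament = record { irrefl = irrefl ; total = total }
        where
        irrefl : ∀ u → prodAdj H₁ H₂ u u ≡ false
        irrefl u with side u
        ... | left a = trans (adj-left a a) (IsTournament.irrefl tour₁ a)
        ... | right b = trans (adj-right b b) (IsTournament.irrefl tour₂ b)
        total : ∀ u w → u ≢ w → prodAdj H₁ H₂ u w ≡ not (prodAdj H₁ H₂ w u)
        total u w u≢w with side u | side w
        ... | left a | left b = begin
          prodAdj H₁ H₂ (a ↑ˡ s₂) (b ↑ˡ s₂) ≡⟨ adj-left a b ⟩
          adj H₁ a b                        ≡⟨ IsTournament.total tour₁ a b (λ { refl → u≢w refl }) ⟩
          not (adj H₁ b a)                  ≡⟨ cong not (sym (adj-left b a)) ⟩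
          not (prodAdj H₁ H₂ (b ↑ˡ s₂) (a ↑ˡ s₂)) ∎
          where open ≡-Reasoning
        ... | right a | right b = begin
          prodAdj H₁ H₂ (s₁ ↑ʳ a) (s₁ ↑ʳ b) ≡⟨ adj-right a b ⟩
          adj H₂ a b                        ≡⟨ IsTournament.total tour₂ a b (λ { refl → u≢w refl }) ⟩
          not (adj H₂ b a)                  ≡⟨ cong not (sym (adj-right b a)) ⟩
          not (prodAdj H₁ H₂ (s₁ ↑ʳ b) (s₁ ↑ʳ a)) ∎
          where open ≡-Reasoning
        ... | left a | right b = trans (adj-left-right a b)
                (trans (<ᵇ-flip (orth a b)) (cong not (sym (adj-right-left a b))))
        ... | right b | left a = trans (adj-right-left a b)
                (trans (<ᵇ-flip (≢-sym (orth a b))) (cong not (sym (adj-left-right a b))))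

      product-injective : Injective _≡_ _≡_ (prodLab H₁ H₂)
      product-injective {u} {w} eq with side u | side w
      ... | left a | left b = cong (_↑ˡ s₂) (inj₁ (trans (sym (lab-left a)) (trans eq (lab-left b))))
      ... | right a | right b = cong (s₁ ↑ʳ_) (inj₂ (trans (sym (lab-right a)) (trans eq (lab-right b))))
      ... | left a | right b = contradiction (trans (sym (lab-left a)) (trans eq (lab-right b))) (orth a b)
      ... | right b | left a = contradiction (trans (sym (lab-left a)) (trans (sym eq) (lab-right b))) (orth a b)

      glue : ∀ {n m} {adjT : Adj n} {v : Data.Vec.Vec Bool m} {η} (χ : Seq n v η) →
        (x : Fin s₁ → Fin n) → Injective _≡_ _≡_ x → (∀ a → x a ∈ longAt χ (lab H₁ a)) →
          (∀ a b → adjT (x a) (x b) ≡ adj H₁ a b) →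
        (y : Fin s₂ → Fin n) → Injective _≡_ _≡_ y → (∀ b → y b ∈ longAt χ (lab H₂ b)) →
          (∀ a b → adjT (y a) (y b) ≡ adj H₂ a b) →
        (∀ a b → x a ≢ y b) →
        (∀ a b → adjT (x a) (y b) ≡ (lab H₁ a <ᵇ lab H₂ b)) →
        (∀ a b → adjT (y b) (x a) ≡ (lab H₂ b <ᵇ lab H₁ a)) →
        Embeds adjT χ (H₁ ⊕ H₂)
      glue {n} {adjT = adjT} χ x x-inj x∈ x-adj y y-inj y∈ y-adj x≢y xy yx = z , z-inj , z∈ , z-adj
        where
        z : Fin (s₁ ℕ.+ s₂) → _
        z u = either x y (splitAt s₁ u)
        z-left : ∀ a → z (a ↑ˡ s₂) ≡ x a
        z-left a rewrite splitAt-↑ˡ s₁ a s₂ = refl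
        z-right : ∀ b → z (s₁ ↑ʳ b) ≡ y b
        z-right b rewrite splitAt-↑ʳ s₁ s₂ b = refl
        z-inj : Injective _≡_ _≡_ z
        z-inj {u} {w} eq with side u | side w
        ... | left a | left b = cong (_↑ˡ s₂) (x-inj (trans (sym (z-left a)) (trans eq (z-left b))))
        ... | right a | right b = cong (s₁ ↑ʳ_) (y-inj (trans (sym (z-right a)) (trans eq (z-right b))))
        ... | left a | right b = contradiction (trans (sym (z-left a)) (trans eq (z-right b))) (x≢y a b)
        ... | right b | left a = contradiction (trans (sym (z-left a)) (trans (sym eq) (z-right b))) (x≢y a b)
        z∈ : ∀ u → z u ∈ longAt χ (prodLab H₁ H₂ u)
        z∈ u with side u
        ... | left a rewrite z-left a | lab-left a = x∈ a
        ... | right b rewrite z-right b | lab-right b = y∈ b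
        z-adj : ∀ u w → adjT (z u) (z w) ≡ prodAdj H₁ H₂ u w
        z-adj u w with side u | side w
        ... | left a | left b rewrite z-left a | z-left b | adj-left a b = x-adj a b
        ... | right a | right b rewrite z-right a | z-right b | adj-right a b = y-adj a b
        ... | left a | right b rewrite z-left a | z-right b | adj-left-right a b = xy a b
        ... | right b | left a rewrite z-right b | z-left a | adj-right-left a b = yx a b

module Theorem where

  open import Data.Bool using (Bool; true; not; if_then_else_)
  open import Data.Fin as Fin using (Fin; toℕ)
  open import Data.Fin.Subset using (Subset; _∈_; _⊆_; ∣_∣; _∩_)
  open import Data.Fin.Subset.Properties using (x∈p∩q⁻; ⊆-trans)
  open import Data.List using (List; []; _∷_)
  open import Data.List.Membership.Propositional using (find; lose) renaming (_∈_ to _∈ₗ_)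
  open import Data.List.Membership.Propositional.Properties
    using (∈-cartesianProductWith⁺; ∈-cartesianProductWith⁻)
  open import Data.List.Relation.Unary.All as All using (All)
  open import Data.List.Relation.Unary.Any using (Any)
  open import Data.Nat as ℕ using (ℕ; suc; _+_; _*_; _∸_; _≤_; _<_; _<ᵇ_)
  open import Data.Nat.Properties
  open import Data.Product using (Σ; _×_; _,_; proj₁; proj₂)
  open import Data.Rational as ℚ using (ℚ; 1ℚ; Positive; NonNegative)
  import Data.Rational.Properties as ℚ
  open import Data.Sum as Sum using (_⊎_; inj₁; inj₂)
  open import Data.Vec as Vec using (Vec)
  open import Function using (_∘_)
  open import Function.Definitions using (Injective)
  open import Relation.Binary using (tri<; tri≈; tri>)
  open import Relation.Binary.PropositionalEquality
  open import Relation.Nullary using (contradiction)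
  open import Defs
  open Counting using (<ᵇ-true; <ᵇ-false)
  open Cleaning
  open Pieces
  open IntegralMSequences
  open UnitFractions
  open RationalMSequences
  open Products

  WellFormed : ∀ {m} (v : Vec Bool m) (η : Vec ℕ (ones v)) → Labelled → Set
  WellFormed v η H = IsTournament (adj H) × Injective _≡_ _≡_ (lab H) × (∀ a → 1 ≤ lab H a × lab H a ≤ kOf v η)

  CopyOrPair : ∀ {m} (v : Vec Bool m) (η : Vec ℕ (ones v)) → Family → (c₁ λ₀ c₂ : ℚ) → Set
  CopyOrPair v η ℋ c₁ λ₀ c₂ =
    ∀ (n : ℕ) (adjT : Adj n) → IsTournament adjT → ∀ (t : ℕ) → IsTr adjT t →
    ∀ (λ' : ℚ) → NonNegative λ' → λ' ℚ.≤ λ₀ → λ' ℚ.< 1ℚ →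
    ∀ (χ : Seq n v η) → IsMSeq adjT t v η c₁ λ' χ →
    Any (Embeds adjT χ) ℋ ⊎ StrongPair adjT t c₂ χ

  EHBound : ∀ {m} (v : Vec Bool m) (η : Vec ℕ (ones v)) → Family → Set
  EHBound v η ℋ = ∀ (c₁ : ℚ) → Positive c₁ →
    Σ ℚ λ λ₀ → Σ ℚ λ c₂ → Positive λ₀ × Positive c₂ × CopyOrPair v η ℋ c₁ λ₀ c₂

  record Instance {m} (v : Vec Bool m) (η : Vec ℕ (ones v)) (ℋ : Family) (c : ℚ) : Set where
    field
      λ₀ c₂ : ℚ
      λ₀>0 : Positive λ₀
      c₂>0 : Positive c₂
      copy-or-pair : CopyOrPair v η ℋ c λ₀ c₂

  instantiate : ∀ {m} {v : Vec Bool m} {η : Vec ℕ (ones v)} {ℋ} → EHBound v η ℋ → ∀ c → Positive c → Instance v η ℋ c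
  instantiate eh c c>0 = let (λ₀ , c₂ , λ₀>0 , c₂>0 , copy-or-pair) = eh c c>0 in
    record { λ₀ = λ₀ ; c₂ = c₂ ; λ₀>0 = λ₀>0 ; c₂>0 = c₂>0 ; copy-or-pair = copy-or-pair }

  product-wellFormed : ∀ {m} (v : Vec Bool m) (η : Vec ℕ (ones v)) (ℋ₁ ℋ₂ : Family) →
    All (WellFormed v η) ℋ₁ → All (WellFormed v η) ℋ₂ → Orthogonal ℋ₁ ℋ₂ →
    All (WellFormed v η) (ℋ₁ ⊕ᶠ ℋ₂)
  product-wellFormed v η ℋ₁ ℋ₂ wf₁ wf₂ orth = All.tabulate λ H∈ →
    let (H₁ , H₂ , H₁∈ , H₂∈ , H≡) = ∈-cartesianProductWith⁻ _⊕_ ℋ₁ ℋ₂ H∈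
        (tour₁ , lab-inj₁ , range₁) = All.lookup wf₁ H₁∈
        (tour₂ , lab-inj₂ , range₂) = All.lookup wf₂ H₂∈
        open Product H₁ H₂
        open Edges tour₁ lab-inj₁ tour₂ lab-inj₂ (All.lookup (All.lookup orth H₁∈) H₂∈)
    in subst (WellFormed v η) (sym H≡) (product-tournament , product-injective , range range₁ range₂)
    where
    range : ∀ {H₁ H₂ k} → (∀ a → 1 ≤ lab H₁ a × lab H₁ a ≤ k) → (∀ b → 1 ≤ lab H₂ b × lab H₂ b ≤ k) →
      ∀ u → 1 ≤ prodLab H₁ H₂ u × prodLab H₁ H₂ u ≤ k
    range {H₁} {H₂} range₁ range₂ u with Product.side H₁ H₂ u
    ... | Product.left a rewrite Product.lab-left H₁ H₂ a = range₁ a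
    ... | Product.right b rewrite Product.lab-right H₁ H₂ b = range₂ b

  transfer-pair : ∀ {n m} {adj : Adj n} {t : ℕ} {v : Vec Bool m} {η : Vec ℕ (ones v)} (χ χ′ : Seq n v η) {c c′ : ℚ} →
    Vχ χ′ ⊆ Vχ χ → c ℚ.≤ c′ → StrongPair adj t c′ χ′ → StrongPair adj t c χ
  transfer-pair {n} {adj = adj} {t} χ χ′ {c} {c′} V⊆V c≤c′ (A , B , A⊆ , B⊆ , disj , A-big , B-big , complete) =
    A , B , ⊆-trans A⊆ V⊆V , ⊆-trans B⊆ V⊆V , disj , scaled-mono n ∣ A ∣ c≤c′ A-big , B-big′ B-big , complete
    where
    B-big′ : (c′ ℚ.* ℕ→ℚ n ℚ.≤ ℕ→ℚ ∣ B ∣ ⊎ (Transitive adj B × c′ ℚ.* ℕ→ℚ t ℚ.≤ ℕ→ℚ ∣ B ∣)) →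
             (c ℚ.* ℕ→ℚ n ℚ.≤ ℕ→ℚ ∣ B ∣ ⊎ (Transitive adj B × c ℚ.* ℕ→ℚ t ℚ.≤ ℕ→ℚ ∣ B ∣))
    B-big′ (inj₁ big) = inj₁ (scaled-mono n ∣ B ∣ c≤c′ big)
    B-big′ (inj₂ (tr , big)) = inj₂ (tr , scaled-mono t ∣ B ∣ c≤c′ big)

  cross-edge : ∀ {n} (adjT : Adj n) → IsTournament adjT → ∀ {j l} {u w : Fin n} → j ≢ l → u ≢ w →
    (if j <ᵇ l then adjT u w else adjT w u) ≡ true →
    adjT u w ≡ (j <ᵇ l) × adjT w u ≡ (l <ᵇ j)
  cross-edge adjT tour {j} {l} {u} {w} j≢l u≢w fwd with <-cmp j l
  ... | tri< j<l _ l≮j rewrite <ᵇ-true j<l | <ᵇ-false l≮j =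
    fwd , trans (IsTournament.total tour w u (u≢w ∘ sym)) (cong not fwd)
  ... | tri≈ _ j≡l _ = contradiction j≡l j≢l
  ... | tri> j≮l _ l<j rewrite <ᵇ-false j≮l | <ᵇ-true l<j =
    trans (IsTournament.total tour u w u≢w) (cong not fwd) , fwd

  record PlacedCopy {n m} (adjT : Adj n) {v : Vec Bool m} {η : Vec ℕ (ones v)}
                    (χ : Seq n v η) (R : Subset n) (H : Labelled) : Set where
    open LongRepresentation v η using (K; part)
    field
      vertex    : Fin (size H) → Fin n
      injective : Injective _≡_ _≡_ vertex
      position  : Fin (size H) → Fin K
      lab≡      : ∀ a → lab H a ≡ suc (toℕ (position a))
      in-part   : ∀ a → vertex a ∈ part χ (toℕ (position a))
      in-R      : ∀ a → vertex a ∈ R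
      preserves : ∀ a b → adjT (vertex a) (vertex b) ≡ adj H a b

    in-long : ∀ a → vertex a ∈ longAt χ (lab H a)
    in-long a rewrite lab≡ a = in-part a

  place : ∀ {n m} {adjT : Adj n} {v : Vec Bool m} {η : Vec ℕ (ones v)} (χ : Seq n v η) (R : Subset n) {H} →
    (∀ a → 1 ≤ lab H a) → Embeds adjT (MSequence.restrict v η R χ) H → PlacedCopy adjT χ R H
  place {v = v} {η} χ R {H} lab≥1 (x , x-inj , x∈ , x-adj) = record
    { vertex = x ; injective = x-inj ; position = λ a → proj₁ (index a)
    ; lab≡ = λ a → trans (sym (m+[n∸m]≡n (lab≥1 a))) (cong suc (sym (proj₂ (index a))))
    ; in-part = λ a → subst (λ j → x a ∈ part χ j) (sym (proj₂ (index a))) (proj₁ (in∩ a))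
    ; in-R = λ a → proj₂ (in∩ a)
    ; preserves = x-adj }
    where
    open LongRepresentation v η
    open MSequence.Restriction v η R χ using (part-restrict)
    in∩ : ∀ a → x a ∈ part χ (lab H a ∸ 1) × x a ∈ R
    in∩ a = x∈p∩q⁻ _ R (subst (x a ∈_) (part-restrict (lab H a ∸ 1)) (x∈ a))
    index : ∀ a → Σ (Fin K) λ j → toℕ j ≡ lab H a ∸ 1
    index a = part-index χ (proj₁ (in∩ a))

  -- Labels are at least 1, so a label f(a) names the part at position f(a) - 1.
  labels≥1 : ∀ {m} {v : Vec Bool m} {η : Vec ℕ (ones v)} {ℋ H} → All (WellFormed v η) ℋ → H ∈ₗ ℋ → ∀ a → 1 ≤ lab H a
  labels≥1 wf H∈ a = proj₁ (proj₂ (proj₂ (All.lookup wf H∈)) a)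

  sumSizes : Family → ℕ
  sumSizes [] = 0
  sumSizes (H ∷ ℋ) = size H + sumSizes ℋ

  size≤sumSizes : ∀ {H ℋ} → H ∈ₗ ℋ → size H ≤ sumSizes ℋ
  size≤sumSizes {ℋ = H ∷ ℋ} (Data.List.Relation.Unary.Any.here refl) = m≤m+n (size H) (sumSizes ℋ)
  size≤sumSizes {ℋ = H′ ∷ ℋ} (Data.List.Relation.Unary.Any.there H∈) = ≤-trans (size≤sumSizes H∈) (m≤n+m (sumSizes ℋ) (size H′))

  module Proof {m : ℕ} (v : Vec Bool m) (η : Vec ℕ (ones v)) (η≥1 : ∀ i → 1 ≤ Vec.lookup η i)
               (ℋ₁ ℋ₂ : Family) (wf₁ : All (WellFormed v η) ℋ₁) (wf₂ : All (WellFormed v η) ℋ₂)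
               (orth : Orthogonal ℋ₁ ℋ₂) (eh₁ : EHBound v η ℋ₁) (eh₂ : EHBound v η ℋ₂)
               (c₁ : ℚ) (c₁>0 : Positive c₁) where
    open LongRepresentation v η
    open MSequence v η

    -- c₁ ≥ 1/N.
    d : ℕ
    d = proj₁ (positive⇒unit≤ c₁ c₁>0)

    N : ℕ
    N = suc d

    -- Both families are used with the constant c′ = 1/(2N).
    c′ : ℚ
    c′ = unit (ℕ.pred (2 * N))

    c′>0 : Positive c′
    c′>0 = unit-positive (ℕ.pred (2 * N))

    module F₁ = Instance (instantiate eh₁ c′ c′>0)
    module F₂ = Instance (instantiate eh₂ c′ c′>0)

    -- The cleaned subsequences will have λ″ ≤ λ of both families, and the
    -- strong pairs found in them constant at least c₂.
    e₁ e₂ g₁ g₂ : ℕ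
    e₁ = proj₁ (positive⇒unit≤ F₁.λ₀ F₁.λ₀>0)
    e₂ = proj₁ (positive⇒unit≤ F₂.λ₀ F₂.λ₀>0)
    g₁ = proj₁ (positive⇒unit≤ F₁.c₂ F₁.c₂>0)
    g₂ = proj₁ (positive⇒unit≤ F₂.c₂ F₂.c₂>0)

    L′ : ℕ
    L′ = suc (e₁ + e₂)

    λ″ c₂ : ℚ
    λ″ = unit L′
    c₂ = unit (g₁ + g₂)

    λ″≤F₁ : λ″ ℚ.≤ F₁.λ₀
    λ″≤F₁ = ℚ.≤-trans (unit-antitone (m≤n⇒m≤1+n (m≤m+n e₁ e₂))) (proj₂ (positive⇒unit≤ F₁.λ₀ F₁.λ₀>0))

    λ″≤F₂ : λ″ ℚ.≤ F₂.λ₀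
    λ″≤F₂ = ℚ.≤-trans (unit-antitone (m≤n⇒m≤1+n (m≤n+m e₂ e₁))) (proj₂ (positive⇒unit≤ F₂.λ₀ F₂.λ₀>0))

    c₂≤F₁ : c₂ ℚ.≤ F₁.c₂
    c₂≤F₁ = ℚ.≤-trans (unit-antitone (m≤m+n g₁ g₂)) (proj₂ (positive⇒unit≤ F₁.c₂ F₁.c₂>0))

    c₂≤F₂ : c₂ ℚ.≤ F₂.c₂
    c₂≤F₂ = ℚ.≤-trans (unit-antitone (m≤n+m g₂ g₁)) (proj₂ (positive⇒unit≤ F₂.c₂ F₂.c₂>0))

    -- At most W vertices are fixed in the first round.
    W : ℕ
    W = suc (sumSizes ℋ₁)

    -- λ₀ = 1/(L+1), where L is large enough for both cleanings.
    L : ℕ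
    L = 2 * (K * (4 * W * (N * N))) + 4 * (N * N) * suc L′

    λ₀ : ℚ
    λ₀ = unit L

    λ₀>0 : Positive λ₀
    λ₀>0 = unit-positive L

    c₂>0 : Positive c₂
    c₂>0 = unit-positive (g₁ + g₂)

    enough-typical : 2 * (K * (4 * W * (N * N))) ≤ suc L
    enough-typical = m≤n⇒m≤1+n (m≤m+n _ _)

    enough-restriction : 4 * (N * N) * suc L′ ≤ suc L
    enough-restriction = m≤n⇒m≤1+n (m≤n+m _ _)

    module Round (n : ℕ) (adjT : Adj n) (tour : IsTournament adjT) (t : ℕ) (tr : IsTr adjT t)
                 (λ' : ℚ) (λ'≥0 : NonNegative λ') (λ'≤λ₀ : λ' ℚ.≤ λ₀)
                 (χ : Seq n v η) (ms : IsMSeq adjT t v η c₁ λ' χ) where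

      msℕ : IsMSeqℕ adjT t v η N (suc L) χ
      msℕ = fromℚ χ ms (proj₂ (positive⇒unit≤ c₁ c₁>0)) λ'≥0 λ'≤λ₀

      open MSequence.Parts v η χ msℕ tr using (parts-disjoint; parts-sparse)
      open InParts adjT (part χ) parts-disjoint
      open Typical K W using (typical; typical-large)

      cleaned : (R : Subset n) → (∀ j → ∣ part χ (toℕ j) ∣ ≤ 2 * ∣ part χ (toℕ j) ∩ R ∣) →
        IsMSeq adjT t v η c′ λ″ (restrict R χ)
      cleaned R halves = toℚ (restrict R χ)
        (HalfRestriction.restricted χ msℕ tr (width-pos v η η≥1) R halves (suc L′) enough-restriction)

      pair-of-cleaned : ∀ R {c} → c₂ ℚ.≤ c → StrongPair adjT t c (restrict R χ) → StrongPair adjT t c₂ χ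
      pair-of-cleaned R c₂≤c = transfer-pair {adj = adjT} {t = t} χ (restrict R χ) (Restriction.Vχ⊆Vχ R χ) c₂≤c

      module SecondRound {H₁ : Labelled} (H₁∈ : H₁ ∈ₗ ℋ₁) (copy₁ : PlacedCopy adjT χ typical H₁) where
        open PlacedCopy copy₁ renaming (vertex to x; position to pos)
        open Compatible K W x pos using (compatible; compatible-forward; compatible-large)

        halves : ∀ j → ∣ part χ (toℕ j) ∣ ≤ 2 * ∣ part χ (toℕ j) ∩ compatible ∣
        halves = compatible-large (m≤n⇒m≤1+n (size≤sumSizes H₁∈)) in-part in-R

        glued : ∀ {H₂} → H₂ ∈ₗ ℋ₂ → PlacedCopy adjT χ compatible H₂ → Embeds adjT χ (H₁ ⊕ H₂)
        glued {H₂} H₂∈ copy₂ =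
          glue {adjT = adjT} χ x injective in-long preserves y C₂.injective C₂.in-long C₂.preserves x≢y x→y y→x
          where
          module C₂ = PlacedCopy copy₂
          y : Fin (size H₂) → Fin n
          y = C₂.vertex
          orth₁₂ : ∀ a b → lab H₁ a ≢ lab H₂ b
          orth₁₂ = All.lookup (All.lookup orth H₁∈) H₂∈
          open Product.Edges H₁ H₂ (proj₁ (All.lookup wf₁ H₁∈)) (proj₁ (proj₂ (All.lookup wf₁ H₁∈)))
                                   (proj₁ (All.lookup wf₂ H₂∈)) (proj₁ (proj₂ (All.lookup wf₂ H₂∈))) orth₁₂
            using (glue)
          different-parts : ∀ a b → toℕ (pos a) ≢ toℕ (C₂.position b)
          different-parts a b e = orth₁₂ a b (trans (lab≡ a) (trans (cong suc e) (sym (C₂.lab≡ b))))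
          x≢y : ∀ a b → x a ≢ y b
          x≢y a b e = parts-disjoint _ _ (different-parts a b) (x a) (in-part a)
                        (subst (_∈ part χ (toℕ (C₂.position b))) (sym e) (C₂.in-part b))
          oriented : ∀ a b → adjT (x a) (y b) ≡ (toℕ (pos a) <ᵇ toℕ (C₂.position b))
                           × adjT (y b) (x a) ≡ (toℕ (C₂.position b) <ᵇ toℕ (pos a))
          oriented a b = cross-edge adjT tour (different-parts a b) (x≢y a b)
            (compatible-forward (C₂.in-R b) a (C₂.position b) (C₂.in-part b) (different-parts a b))
          x→y : ∀ a b → adjT (x a) (y b) ≡ (lab H₁ a <ᵇ lab H₂ b)
          x→y a b = trans (proj₁ (oriented a b)) (sym (cong₂ _<ᵇ_ (lab≡ a) (C₂.lab≡ b)))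
          y→x : ∀ a b → adjT (y b) (x a) ≡ (lab H₂ b <ᵇ lab H₁ a)
          y→x a b = trans (proj₂ (oriented a b)) (sym (cong₂ _<ᵇ_ (C₂.lab≡ b) (lab≡ a)))

        copy-of-product : Any (Embeds adjT (restrict compatible χ)) ℋ₂ → Any (Embeds adjT χ) (ℋ₁ ⊕ᶠ ℋ₂)
        copy-of-product found = let (H₂ , H₂∈ , emb) = find found in
          lose (∈-cartesianProductWith⁺ _⊕_ H₁∈ H₂∈) (glued H₂∈ (place χ compatible (labels≥1 {v = v} {η} wf₂ H₂∈) emb))

        outcome : Any (Embeds adjT (restrict compatible χ)) ℋ₂ ⊎ StrongPair adjT t F₂.c₂ (restrict compatible χ)
        outcome = F₂.copy-or-pair n adjT tour t tr λ″ (unit-nonNegative L′) λ″≤F₂ (unit<1 (e₁ + e₂))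
                    (restrict compatible χ) (cleaned compatible halves)

        result : Any (Embeds adjT χ) (ℋ₁ ⊕ᶠ ℋ₂) ⊎ StrongPair adjT t c₂ χ
        result = Sum.map copy-of-product (pair-of-cleaned compatible c₂≤F₂) outcome

      outcome : Any (Embeds adjT (restrict typical χ)) ℋ₁ ⊎ StrongPair adjT t F₁.c₂ (restrict typical χ)
      outcome = F₁.copy-or-pair n adjT tour t tr λ″ (unit-nonNegative L′) λ″≤F₁ (unit<1 (e₁ + e₂))
                  (restrict typical χ) (cleaned typical (typical-large (N * N) (suc L) parts-sparse enough-typical))

      second-round : Any (Embeds adjT (restrict typical χ)) ℋ₁ → Any (Embeds adjT χ) (ℋ₁ ⊕ᶠ ℋ₂) ⊎ StrongPair adjT t c₂ χ
      second-round found = let (H₁ , H₁∈ , emb) = find found in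
        SecondRound.result H₁∈ (place χ typical (labels≥1 {v = v} {η} wf₁ H₁∈) emb)

      result : Any (Embeds adjT χ) (ℋ₁ ⊕ᶠ ℋ₂) ⊎ StrongPair adjT t c₂ χ
      result = Sum.[ second-round , inj₂ ∘ pair-of-cleaned typical c₂≤F₁ ]′ outcome

open Theorem using (product-wellFormed; EHBound; module Proof)

theorem9 : ∀ {m} (v : Vec Bool m) (η : Vec ℕ (ones v)) →
    (∀ i → 1 ≤ lookup η i) →
    (ℋ₁ ℋ₂ : Family) →
    StrongEH v η ℋ₁ → StrongEH v η ℋ₂ → Orthogonal ℋ₁ ℋ₂ →
    StrongEH v η (ℋ₁ ⊕ᶠ ℋ₂)
theorem9 v η η≥1 ℋ₁ ℋ₂ (wf₁ , eh₁) (wf₂ , eh₂) orth =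
  product-wellFormed v η ℋ₁ ℋ₂ wf₁ wf₂ orth , bound
  where
  bound : EHBound v η (ℋ₁ ⊕ᶠ ℋ₂)
  bound c₁ c₁>0 = λ₀ , c₂ , λ₀>0 , c₂>0 ,
    λ n adjT tour t tr λ' λ'≥0 λ'≤λ₀ _ → Round.result n adjT tour t tr λ' λ'≥0 λ'≤λ₀
    where open Proof v η η≥1 ℋ₁ ℋ₂ wf₁ wf₂ orth eh₁ eh₂ c₁ c₁>0
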